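{- Let $k$ be a non-negative integer and $m$ a positive integer. For $|q|<1$, and for either choice of sign (upper signs throughout, or lower signs throughout), \begin{enumerate} \item[(i)] $\displaystyle \sum_{j=k}^\infty (\mp 1)^{j-k} \binom{2j}{j-k} V^{\pm}_{j,m}(q) = (\pm q;q)^2_m\,q^k\, H_{k,m}(q,q^2)$; \item[(ii)] $\displaystyle \sum_{j=k}^\infty (\mp 1)^{j-k} \binom{2j}{j-k} W^{\pm}_{j,m}(q)=(\pm q;q^2)^2_m\,q^k\,H_{k,m}(q^2,q^2)$. \end{enumerate}
   Context: For $n\ge 0$, $(a;q)_n=\prod_{r=0}^{n-1}(1-aq^r)$ with $(a;q)_0=1$. For integers $m,k$ and a base $p$, the Gaussian polynomial is ${m \brack k}_p=\frac{(p;p)_m}{(p;p)_k(p;p)_{m-k}}$ if $0\le k\le m$ and $0$ otherwise. For non-negative integers $k,m$ define $$V^{\pm}_{k,m}(q)=\sum_{1\le n_1\le n_2\le\cdots\le n_k\le m}\prod_{i=1}^k\frac{q^{n_i}}{(1\mp q^{n_i})^2},\qquad W^{\pm}_{k,m}(q)=\sum_{1\le n_1\le\cdots\le n_k\le m}\prod_{i=1}^k\frac{q^{2n_i-1}}{(1\mp q^{2n_i-1})^2},$$ with $V^{\pm}_{0,m}(q)=W^{\pm}_{0,m}(q)=1$. Define $$H_{k,m}(p,z)=\sum_{j=0}^\infty {m-1+j \brack j}_p {m-1+k+j \brack k+j}_p z^{j},$$ so that $H_{k,m}(q,q^2)$ uses base $q$ and $z=q^2$, and $H_{k,m}(q^2,q^2)$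 uses base $q^2$ and $z=q^2$. -}

module Defs where

-- Formal power series in q with integer coefficients, represented by their
-- coefficient functions  ℕ → ℤ  (coefficient of q^n).

open import Data.Nat as ℕ using (ℕ; zero; suc; _≟_; _≤?_)
open import Data.Nat.Combinatorics using (_C_)
open import Data.Integer using (ℤ; +_; -_; _+_; _*_; _-_; 0ℤ; 1ℤ; _^_)
open import Relation.Nullary using (yes; no)

Series : Set
Series = ℕ → ℤ

Σ< : ℕ → (ℕ → ℤ) → ℤ
Σ< zero    f = 0ℤ
Σ< (suc n) f = Σ< n f + f n

const : ℤ → Series
const c zero    = c
const c (suc _) = 0ℤ

one : Series
one = const 1ℤ

zeroS : Series
zeroS _ = 0ℤ

mono : ℕ → ℤ → Series
mono e c n with n ≟ e
... | yes _ = c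
... | no  _ = 0ℤ

X^ : ℕ → Series
X^ e = mono e 1ℤ

infixl 6 _⊕_ _⊖_
infixl 7 _⊛_ _·_

_⊕_ : Series → Series → Series
(f ⊕ g) n = f n + g n

_⊖_ : Series → Series → Series
(f ⊖ g) n = f n - g n

_·_ : ℤ → Series → Series
(c · f) n = c * f n

_⊛_ : Series → Series → Series
(f ⊛ g) n = Σ< (suc n) (λ i → f i * g (n ℕ.∸ i))

ΣS< : ℕ → (ℕ → Series) → Series
ΣS< zero    F = zeroS
ΣS< (suc n) F = ΣS< n F ⊕ F n

ΠS< : ℕ → (ℕ → Series) → Series
ΠS< zero    F = one
ΠS< (suc n) F = ΠS< n F ⊛ F n

-- Multiplicative inverse of a series with constant term 1:
-- b 0 = 1,  b N = - Σ_{i=1}^{N} f i * b (N - i).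
-- invPrefix f N is correct at all indices ≤ N.
invPrefix : Series → ℕ → Series
invPrefix f zero i with i
... | zero  = 1ℤ
... | suc _ = 0ℤ
invPrefix f (suc N) i with i ≟ suc N
... | yes _ = - Σ< (suc N) (λ i → f (suc i) * invPrefix f N (N ℕ.∸ i))
... | no  _ = invPrefix f N i

inv : Series → Series
inv f N = invPrefix f N N

-- (c q^s ; q^d)_n = Π_{r<n} (1 - c q^{s + d r})
poch : ℤ → ℕ → ℕ → ℕ → Series
poch c s d n = ΠS< n (λ r → one ⊖ mono (s ℕ.+ d ℕ.* r) c)

-- Gaussian polynomial [m, k] in base p = q^d, as a series in q
gauss : ℕ → ℕ → ℕ → Series
gauss d m k with k ≤? m
... | yes _ = poch 1ℤ d d m ⊛ inv (poch 1ℤ d d k) ⊛ inv (poch 1ℤ d d (m ℕ.∸ k))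
... | no  _ = zeroS

-- partial sum Σ_{j=0}^{J} [m-1+j, j]_p [m-1+k+j, k+j]_p z^j, with p = q^d, z = q^2
Hpart : ℕ → ℕ → ℕ → ℕ → Series
Hpart d k m J = ΣS< (suc J) (λ j →
  gauss d (m ℕ.∸ 1 ℕ.+ j) j ⊛ gauss d (m ℕ.∸ 1 ℕ.+ k ℕ.+ j) (k ℕ.+ j) ⊛ X^ (2 ℕ.* j))

frac : ℤ → ℕ → Series
frac ε e = X^ e ⊛ inv ((one ⊖ mono e ε) ⊛ (one ⊖ mono e ε))

-- Σ_{1≤n_1≤...≤n_k≤m} Π_i frac ε (e n_i), by recursion on k
-- (splitting off the largest index n_k = n).
Vgen : (ℕ → ℕ) → ℤ → ℕ → ℕ → Series
Vgen e ε zero    m = one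
Vgen e ε (suc k) m = ΣS< m (λ n → frac ε (e (suc n)) ⊛ Vgen e ε k (suc n))

-- V^±_{k,m}, with ε = +1 for the upper sign (denominator (1 - q^n)^2),
-- ε = -1 for the lower sign.
V : ℤ → ℕ → ℕ → Series
V ε = Vgen (λ n → n) ε

W : ℤ → ℕ → ℕ → Series
W ε = Vgen (λ n → 2 ℕ.* n ℕ.∸ 1) ε

LHSpart : (ℕ → Series) → ℤ → ℕ → ℕ → Series
LHSpart A ε k J = ΣS< (suc J) (λ i →
  ((- ε) ^ i * + ((2 ℕ.* (k ℕ.+ i)) C i)) · A (k ℕ.+ i))

-- Work in ℤ[[q]] with z_n = q^{e(n)} and x_n = z_n / (1 - ε z_n)², so that V and W are the
-- complete homogeneous symmetric functions h_j(x_1, …, x_m) for e(n) = n and e(n) = 2n - 1.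
-- Because ε² = 1,
--   1 - x_n (t - 2ε + t⁻¹) = (1 - z_n t) (1 - z_n t⁻¹) / (1 - ε z_n)²,
-- and taking the product of the inverses over n ≤ m and the coefficient of t^k gives
--   Σ_j α_{jk} h_j(x) = Π_n (1 - ε z_n)² · Σ_b h_{k+b}(z) h_b(z),
-- where α_{jk} = [t^k] (t - 2ε + t⁻¹)^j = (-ε)^{j-k} C(2j, j-k). Instead of Laurent series in t,
-- this is proved by induction on m: multiplication by (1 - z t) (1 - z t⁻¹) for the new variable z,
-- written on coefficient families, sends both sides for m + 1 variables to (1 - ε z)² times those
-- for m variables, and it is injective because z has positive order.
-- Finally h_a(q, q^{1+d}, …, q^{1+d(m-1)}) = q^a [m-1+a, a]_{q^d} by q-Pascal, which turns
-- q^{-k} Σ_b h_{k+b}(z) h_b(z) into H_{k,m}(q^d, q²).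

{-# OPTIONS --safe #-}
module Submission where

open import Defs
open import Algebra.Bundles using (CommutativeRing)
open import Algebra.Solver.Ring.AlmostCommutativeRing
  using (fromCommutativeRing; _-Raw-AlmostCommutative⟶_)
open import Data.Empty using (⊥-elim)
open import Data.Integer as ℤ using (ℤ; +_; -_; _+_; _*_; _-_; _^_; 0ℤ; 1ℤ; -1ℤ)
import Data.Integer.Properties as ℤP
import Data.Integer.Tactic.RingSolver as ℤ-Solver
open import Data.Maybe using (Maybe; just; nothing)
open import Data.Nat as ℕ using (ℕ; zero; suc; _∸_; _<_; _≤_; z≤n; s≤s; _≟_)
open import Data.Nat.Combinatorics using (_C_; nCk+nC[k+1]≡[n+1]C[k+1]; nCk≡nC[n∸k]; k>n⇒nCk≡0)
import Data.Nat.Properties as ℕP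
import Data.Nat.Tactic.RingSolver as ℕ-Solver
open import Data.Product using (_×_; _,_; ∃-syntax)
open import Data.Sum using (_⊎_; inj₁; inj₂)
open import Function using (_∘_)
open import Level using (0ℓ)
open import Relation.Binary.PropositionalEquality
import Relation.Binary.Reasoning.Setoid
open import Relation.Nullary using (yes; no)

Σ<-cong-< : ∀ n {F G : ℕ → ℤ} → (∀ i → i < n → F i ≡ G i) → Σ< n F ≡ Σ< n G
Σ<-cong-< zero    F≡G = refl
Σ<-cong-< (suc n) F≡G =
  cong₂ _+_ (Σ<-cong-< n (λ i i<n → F≡G i (ℕP.m<n⇒m<1+n i<n))) (F≡G n ℕP.≤-refl)

Σ<-cong : ∀ n {F G : ℕ → ℤ} → (∀ i → F i ≡ G i) → Σ< n F ≡ Σ< n G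
Σ<-cong n F≡G = Σ<-cong-< n (λ i _ → F≡G i)

Σ<-zero : ∀ n {F : ℕ → ℤ} → (∀ i → i < n → F i ≡ 0ℤ) → Σ< n F ≡ 0ℤ
Σ<-zero zero    F≡0 = refl
Σ<-zero (suc n) F≡0 = cong₂ _+_ (Σ<-zero n (λ i i<n → F≡0 i (ℕP.m<n⇒m<1+n i<n))) (F≡0 n ℕP.≤-refl)

Σ<-distrib-+ : ∀ n (F G : ℕ → ℤ) → Σ< n (λ i → F i + G i) ≡ Σ< n F + Σ< n G
Σ<-distrib-+ zero    F G = refl
Σ<-distrib-+ (suc n) F G = begin
  Σ< n (λ i → F i + G i) + (F n + G n)  ≡⟨ cong (_+ (F n + G n)) (Σ<-distrib-+ n F G) ⟩
  (Σ< n F + Σ< n G) + (F n + G n)       ≡⟨ interchange (Σ< n F) (Σ< n G) (F n) (G n) ⟩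
  (Σ< n F + F n) + (Σ< n G + G n)       ∎
  where
  open ≡-Reasoning
  open import Algebra.Properties.CommutativeSemigroup ℤP.+-commutativeSemigroup using (interchange)

*-distribˡ-Σ< : ∀ n c (F : ℕ → ℤ) → c * Σ< n F ≡ Σ< n (λ i → c * F i)
*-distribˡ-Σ< zero    c F = ℤP.*-zeroʳ c
*-distribˡ-Σ< (suc n) c F =
  trans (ℤP.*-distribˡ-+ c (Σ< n F) (F n)) (cong (_+ c * F n) (*-distribˡ-Σ< n c F))

*-distribʳ-Σ< : ∀ n c (F : ℕ → ℤ) → Σ< n F * c ≡ Σ< n (λ i → F i * c)
*-distribʳ-Σ< n c F = begin
  Σ< n F * c               ≡⟨ ℤP.*-comm (Σ< n F) c ⟩
  c * Σ< n F               ≡⟨ *-distribˡ-Σ< n c F ⟩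
  Σ< n (λ i → c * F i)     ≡⟨ Σ<-cong n (λ i → ℤP.*-comm c (F i)) ⟩
  Σ< n (λ i → F i * c)     ∎
  where open ≡-Reasoning

neg-distrib-Σ< : ∀ n (F : ℕ → ℤ) → - Σ< n F ≡ Σ< n (λ i → - F i)
neg-distrib-Σ< zero    F = refl
neg-distrib-Σ< (suc n) F =
  trans (ℤP.neg-distrib-+ (Σ< n F) (F n)) (cong (_+ - F n) (neg-distrib-Σ< n F))

Σ<-unconsˡ : ∀ n (F : ℕ → ℤ) → Σ< (suc n) F ≡ F 0 + Σ< n (F ∘ suc)
Σ<-unconsˡ zero    F = trans (ℤP.+-identityˡ (F 0)) (sym (ℤP.+-identityʳ (F 0)))
Σ<-unconsˡ (suc n) F = begin
  Σ< (suc n) F + F (suc n)             ≡⟨ cong (_+ F (suc n)) (Σ<-unconsˡ n F) ⟩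
  (F 0 + Σ< n (F ∘ suc)) + F (suc n)   ≡⟨ ℤP.+-assoc (F 0) _ _ ⟩
  F 0 + Σ< (suc n) (F ∘ suc)           ∎
  where open ≡-Reasoning

Σ<-reverse : ∀ n (F : ℕ → ℤ) → Σ< n F ≡ Σ< n (λ i → F (n ∸ suc i))
Σ<-reverse zero    F = refl
Σ<-reverse (suc n) F = begin
  Σ< n F + F n                           ≡⟨ cong (_+ F n) (Σ<-reverse n F) ⟩
  Σ< n (λ i → F (n ∸ suc i)) + F n       ≡⟨ ℤP.+-comm _ (F n) ⟩
  F n + Σ< n (λ i → F (n ∸ suc i))       ≡⟨ Σ<-unconsˡ n (λ i → F (n ∸ i)) ⟨
  Σ< (suc n) (λ i → F (n ∸ i))           ∎
  where open ≡-Reasoning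

Σ<-comm : ∀ n m (F : ℕ → ℕ → ℤ) →
          Σ< n (λ i → Σ< m (λ j → F i j)) ≡ Σ< m (λ j → Σ< n (λ i → F i j))
Σ<-comm zero    m F = sym (Σ<-zero m (λ _ _ → refl))
Σ<-comm (suc n) m F = begin
  Σ< n (λ i → Σ< m (λ j → F i j)) + Σ< m (λ j → F n j)
    ≡⟨ cong (_+ Σ< m (λ j → F n j)) (Σ<-comm n m F) ⟩
  Σ< m (λ j → Σ< n (λ i → F i j)) + Σ< m (λ j → F n j)
    ≡⟨ Σ<-distrib-+ m _ _ ⟨
  Σ< m (λ j → Σ< (suc n) (λ i → F i j)) ∎
  where open ≡-Reasoning

Σ<-extend : ∀ {n m} (F : ℕ → ℤ) → n ≤ m → (∀ i → n ≤ i → F i ≡ 0ℤ) → Σ< m F ≡ Σ< n F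
Σ<-extend {m = zero} F z≤n _ = refl
Σ<-extend {n} {suc m} F n≤1+m tail≡0 with ℕP.m≤n⇒m<n∨m≡n n≤1+m
... | inj₂ refl      = refl
... | inj₁ (s≤s n≤m) = begin
  Σ< m F + F m   ≡⟨ cong (λ t → Σ< m F + t) (tail≡0 m n≤m) ⟩
  Σ< m F + 0ℤ    ≡⟨ ℤP.+-identityʳ _ ⟩
  Σ< m F         ≡⟨ Σ<-extend F n≤m tail≡0 ⟩
  Σ< n F         ∎
  where open ≡-Reasoning

Σ<-single : ∀ n e (F : ℕ → ℤ) → e < n → (∀ i → i ≢ e → F i ≡ 0ℤ) → Σ< n F ≡ F e
Σ<-single (suc n) e F e<1+n F≡0 with e ≟ n
... | yes refl = trans (cong (_+ F e) (Σ<-zero e (λ i i<e → F≡0 i (ℕP.<⇒≢ i<e))))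
                       (ℤP.+-identityˡ (F e))
... | no e≢n   = trans (cong₂ _+_ (Σ<-single n e F (ℕP.≤∧≢⇒< (ℕP.≤-pred e<1+n) e≢n) F≡0)
                                  (F≡0 n (e≢n ∘ sym)))
                       (ℤP.+-identityʳ (F e))

Σ<-triangle : ∀ n (T : ℕ → ℕ → ℤ) →
  Σ< (suc n) (λ i → Σ< (suc i) (λ a → T a i)) ≡
  Σ< (suc n) (λ a → Σ< (suc (n ∸ a)) (λ b → T a (a ℕ.+ b)))
Σ<-triangle zero    T = refl
Σ<-triangle (suc n) T = begin
  Σ< (suc n) (λ i → Σ< (suc i) (λ a → T a i)) + Σ< (suc (suc n)) (λ a → T a (suc n))
    ≡⟨ cong (_+ Σ< (suc (suc n)) (λ a → T a (suc n))) (Σ<-triangle n T) ⟩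
  Rows n + (Σ< (suc n) (λ a → T a (suc n)) + T (suc n) (suc n))
    ≡⟨ ℤP.+-assoc (Rows n) _ _ ⟨
  (Rows n + Σ< (suc n) (λ a → T a (suc n))) + T (suc n) (suc n)
    ≡⟨ cong (_+ T (suc n) (suc n)) (Σ<-distrib-+ (suc n) _ _) ⟨
  Σ< (suc n) (λ a → Row n a + T a (suc n)) + T (suc n) (suc n)
    ≡⟨ cong₂ _+_ (Σ<-cong-< (suc n) extendRow) lastRow ⟩
  Rows (suc n) ∎
  where
  open ≡-Reasoning
  Row : ℕ → ℕ → ℤ
  Row n a = Σ< (suc (n ∸ a)) (λ b → T a (a ℕ.+ b))
  Rows : ℕ → ℤ
  Rows n = Σ< (suc n) (Row n)
  extendRow : ∀ a → a < suc n → Row n a + T a (suc n) ≡ Row (suc n) a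
  extendRow a (s≤s a≤n) = begin
    Row n a + T a (suc n)
      ≡⟨ cong (λ i → Row n a + T a i)
              (trans (ℕP.+-suc a (n ∸ a)) (cong suc (ℕP.m+[n∸m]≡n a≤n))) ⟨
    Σ< (suc (suc (n ∸ a))) (λ b → T a (a ℕ.+ b))
      ≡⟨ cong (λ i → Σ< (suc i) (λ b → T a (a ℕ.+ b))) (ℕP.+-∸-assoc 1 a≤n) ⟨
    Row (suc n) a ∎
  lastRow : T (suc n) (suc n) ≡ Row (suc n) (suc n)
  lastRow = begin
    T (suc n) (suc n)         ≡⟨ cong (T (suc n)) (ℕP.+-identityʳ (suc n)) ⟨
    T (suc n) (suc n ℕ.+ 0)   ≡⟨ ℤP.+-identityˡ _ ⟨
    Σ< 1 (λ b → T (suc n) (suc n ℕ.+ b))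
      ≡⟨ cong (λ i → Σ< (suc i) (λ b → T (suc n) (suc n ℕ.+ b))) (ℕP.n∸n≡0 n) ⟨
    Row (suc n) (suc n) ∎

infix 4 _≈_

record _≈_ (f g : Series) : Set where
  constructor mk≈
  field coeff : ∀ n → f n ≡ g n

open _≈_ public

≈-refl : ∀ {f} → f ≈ f
≈-refl = mk≈ λ _ → refl

≈-sym : ∀ {f g} → f ≈ g → g ≈ f
≈-sym f≈g = mk≈ λ n → sym (coeff f≈g n)

≈-trans : ∀ {f g h} → f ≈ g → g ≈ h → f ≈ h
≈-trans f≈g g≈h = mk≈ λ n → trans (coeff f≈g n) (coeff g≈h n)

neg : Series → Series
neg f n = - f n

⊕-cong : ∀ {f f′ g g′} → f ≈ f′ → g ≈ g′ → f ⊕ g ≈ f′ ⊕ g′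
⊕-cong f≈f′ g≈g′ = mk≈ λ n → cong₂ _+_ (coeff f≈f′ n) (coeff g≈g′ n)

-- The fixed operand is explicit: unification cannot recover it from f ⊕ g or f ⊛ g.
⊕-congˡ : ∀ f {g g′} → g ≈ g′ → f ⊕ g ≈ f ⊕ g′
⊕-congˡ f = ⊕-cong {f} ≈-refl

⊕-congʳ : ∀ g {f f′} → f ≈ f′ → f ⊕ g ≈ f′ ⊕ g
⊕-congʳ g f≈f′ = ⊕-cong {g = g} f≈f′ ≈-refl

neg-cong : ∀ {f f′} → f ≈ f′ → neg f ≈ neg f′
neg-cong f≈f′ = mk≈ λ n → cong -_ (coeff f≈f′ n)

⊛-cong : ∀ {f f′ g g′} → f ≈ f′ → g ≈ g′ → f ⊛ g ≈ f′ ⊛ g′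
⊛-cong f≈f′ g≈g′ = mk≈ λ n →
  Σ<-cong (suc n) (λ i → cong₂ _*_ (coeff f≈f′ i) (coeff g≈g′ (n ∸ i)))

⊛-congˡ : ∀ f {g g′} → g ≈ g′ → f ⊛ g ≈ f ⊛ g′
⊛-congˡ f = ⊛-cong {f} ≈-refl

⊛-congʳ : ∀ g {f f′} → f ≈ f′ → f ⊛ g ≈ f′ ⊛ g
⊛-congʳ g f≈f′ = ⊛-cong {g = g} f≈f′ ≈-refl

⊛-comm : ∀ f g → f ⊛ g ≈ g ⊛ f
⊛-comm f g = mk≈ λ n → begin
  Σ< (suc n) (λ i → f i * g (n ∸ i))                 ≡⟨ Σ<-reverse (suc n) _ ⟩
  Σ< (suc n) (λ i → f (n ∸ i) * g (n ∸ (n ∸ i)))     ≡⟨ Σ<-cong-< (suc n) (λ i i≤n →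
    trans (cong (λ j → f (n ∸ i) * g j) (ℕP.m∸[m∸n]≡n (ℕP.≤-pred i≤n)))
          (ℤP.*-comm (f (n ∸ i)) (g i))) ⟩
  Σ< (suc n) (λ i → g i * f (n ∸ i))                 ∎
  where open ≡-Reasoning

⊛-assoc : ∀ f g h → (f ⊛ g) ⊛ h ≈ f ⊛ (g ⊛ h)
⊛-assoc f g h = mk≈ λ n → begin
  Σ< (suc n) (λ i → Σ< (suc i) (λ a → f a * g (i ∸ a)) * h (n ∸ i))
    ≡⟨ Σ<-cong (suc n) (λ i → *-distribʳ-Σ< (suc i) (h (n ∸ i)) _) ⟩
  Σ< (suc n) (λ i → Σ< (suc i) (λ a → f a * g (i ∸ a) * h (n ∸ i)))
    ≡⟨ Σ<-triangle n (λ a i → f a * g (i ∸ a) * h (n ∸ i)) ⟩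
  Σ< (suc n) (λ a → Σ< (suc (n ∸ a)) (λ b → f a * g (a ℕ.+ b ∸ a) * h (n ∸ (a ℕ.+ b))))
    ≡⟨ Σ<-cong (suc n) (λ a → Σ<-cong (suc (n ∸ a)) (λ b →
         trans (cong₂ (λ i j → f a * g i * h j) (ℕP.m+n∸m≡n a b) (sym (ℕP.∸-+-assoc n a b)))
               (ℤP.*-assoc (f a) (g b) (h (n ∸ a ∸ b))))) ⟩
  Σ< (suc n) (λ a → Σ< (suc (n ∸ a)) (λ b → f a * (g b * h (n ∸ a ∸ b))))
    ≡⟨ Σ<-cong (suc n) (λ a → *-distribˡ-Σ< (suc (n ∸ a)) (f a) _) ⟨
  Σ< (suc n) (λ a → f a * Σ< (suc (n ∸ a)) (λ b → g b * h (n ∸ a ∸ b))) ∎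
  where open ≡-Reasoning

⊛-distribʳ-⊕ : ∀ f g h → (g ⊕ h) ⊛ f ≈ g ⊛ f ⊕ h ⊛ f
⊛-distribʳ-⊕ f g h = mk≈ λ n →
  trans (Σ<-cong (suc n) (λ i → ℤP.*-distribʳ-+ (f (n ∸ i)) (g i) (h i))) (Σ<-distrib-+ (suc n) _ _)

⊛-distribˡ-⊕ : ∀ f g h → f ⊛ (g ⊕ h) ≈ f ⊛ g ⊕ f ⊛ h
⊛-distribˡ-⊕ f g h = mk≈ λ n →
  trans (Σ<-cong (suc n) (λ i → ℤP.*-distribˡ-+ (f i) (g (n ∸ i)) (h (n ∸ i)))) (Σ<-distrib-+ (suc n) _ _)

const-⊛ : ∀ c f → const c ⊛ f ≈ c · f
const-⊛ c f = mk≈ λ n → begin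
  Σ< (suc n) (λ i → const c i * f (n ∸ i))        ≡⟨ Σ<-unconsˡ n _ ⟩
  c * f n + Σ< n (λ i → 0ℤ * f (n ∸ suc i))
    ≡⟨ cong (λ t → c * f n + t) (Σ<-zero n (λ i _ → ℤP.*-zeroˡ (f (n ∸ suc i)))) ⟩
  c * f n + 0ℤ                                    ≡⟨ ℤP.+-identityʳ _ ⟩
  c * f n                                         ∎
  where open ≡-Reasoning

⊛-identityˡ : ∀ f → one ⊛ f ≈ f
⊛-identityˡ f = ≈-trans (const-⊛ 1ℤ f) (mk≈ λ n → ℤP.*-identityˡ (f n))

⊛-identityʳ : ∀ f → f ⊛ one ≈ f
⊛-identityʳ f = ≈-trans (⊛-comm f one) (⊛-identityˡ f)

⊛-zeroʳ : ∀ f → f ⊛ zeroS ≈ zeroS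
⊛-zeroʳ f = mk≈ λ n → Σ<-zero (suc n) (λ i _ → ℤP.*-zeroʳ (f i))

seriesRing : CommutativeRing 0ℓ 0ℓ
seriesRing = record
  { Carrier = Series ; _≈_ = _≈_ ; _+_ = _⊕_ ; _*_ = _⊛_ ; -_ = neg ; 0# = zeroS ; 1# = one
  ; isCommutativeRing = record
    { isRing = record
      { +-isAbelianGroup = record
        { isGroup = record
          { isMonoid = record
            { isSemigroup = record
              { isMagma = record
                { isEquivalence = record { refl = ≈-refl ; sym = ≈-sym ; trans = ≈-trans }
                ; ∙-cong = ⊕-cong }
              ; assoc = λ f g h → mk≈ λ n → ℤP.+-assoc (f n) (g n) (h n) }
            ; identity = (λ f → mk≈ λ n → ℤP.+-identityˡ (f n))
                       , (λ f → mk≈ λ n → ℤP.+-identityʳ (f n)) }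
          ; inverse = (λ f → mk≈ λ n → ℤP.+-inverseˡ (f n))
                    , (λ f → mk≈ λ n → ℤP.+-inverseʳ (f n))
          ; ⁻¹-cong = neg-cong }
        ; comm = λ f g → mk≈ λ n → ℤP.+-comm (f n) (g n) }
      ; *-cong = ⊛-cong
      ; *-assoc = ⊛-assoc
      ; *-identity = ⊛-identityˡ , ⊛-identityʳ
      ; distrib = ⊛-distribˡ-⊕ , ⊛-distribʳ-⊕ }
    ; *-comm = ⊛-comm } }

module ≈-Reasoning = Relation.Binary.Reasoning.Setoid (CommutativeRing.setoid seriesRing)

constHomomorphism : ℤ.+-*-rawRing -Raw-AlmostCommutative⟶ fromCommutativeRing seriesRing
constHomomorphism = record
  { ⟦_⟧    = const
  ; +-homo = λ _ _ → mk≈ λ { zero → refl ; (suc _) → refl }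
  ; *-homo = λ x y → ≈-sym (≈-trans (const-⊛ x (const y)) (mk≈ (*-const x y)))
  ; -‿homo = λ _ → mk≈ λ { zero → refl ; (suc _) → refl }
  ; 0-homo = mk≈ λ { zero → refl ; (suc _) → refl }
  ; 1-homo = mk≈ λ { zero → refl ; (suc _) → refl } }
  where
  *-const : ∀ x y n → x * const y n ≡ const (x * y) n
  *-const x y zero    = refl
  *-const x y (suc n) = ℤP.*-zeroʳ x

const-≟ : ∀ x y → Maybe (const x ≈ const y)
const-≟ x y with x ℤ.≟ y
... | yes refl = just ≈-refl
... | no _     = nothing

open import Algebra.Solver.Ring ℤ.+-*-rawRing (fromCommutativeRing seriesRing) constHomomorphism const-≟
  using (solve; _:=_; _:+_; _:*_; :-_; _:-_; con)

⊕-neg≈zero⇒≈ : ∀ {a b} → a ⊕ neg b ≈ zeroS → a ≈ b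
⊕-neg≈zero⇒≈ {a} {b} a-b≈0 = begin
  a                     ≈⟨ solve 2 (λ a b → a := (a :- b) :+ b) ≈-refl a b ⟩
  (a ⊕ neg b) ⊕ b       ≈⟨ ⊕-congʳ b a-b≈0 ⟩
  zeroS ⊕ b             ≈⟨ mk≈ (λ n → ℤP.+-identityˡ (b n)) ⟩
  b                     ∎
  where open ≈-Reasoning

mono-≢ : ∀ e c {n} → n ≢ e → mono e c n ≡ 0ℤ
mono-≢ e c {n} n≢e with n ≟ e
... | yes n≡e = ⊥-elim (n≢e n≡e)
... | no _    = refl

mono-≡ : ∀ e c → mono e c e ≡ c
mono-≡ e c with e ≟ e
... | yes _   = refl
... | no e≢e  = ⊥-elim (e≢e refl)

*-mono : ∀ c e d n → c * mono e d n ≡ mono e (c * d) n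
*-mono c e d n with n ≟ e
... | yes _ = refl
... | no _  = ℤP.*-zeroʳ c

mono-shift : ∀ a e c m → mono (a ℕ.+ e) c (a ℕ.+ m) ≡ mono e c m
mono-shift a e c m with a ℕ.+ m ≟ a ℕ.+ e | m ≟ e
... | yes _    | yes _   = refl
... | no _     | no _    = refl
... | yes a+m≡a+e | no m≢e = ⊥-elim (m≢e (ℕP.+-cancelˡ-≡ a m e a+m≡a+e))
... | no a+m≢a+e  | yes m≡e = ⊥-elim (a+m≢a+e (cong (a ℕ.+_) m≡e))

mono-⊛-≥ : ∀ {e n} c f → e ≤ n → (mono e c ⊛ f) n ≡ c * f (n ∸ e)
mono-⊛-≥ {e} {n} c f e≤n =
  trans (Σ<-single (suc n) e _ (s≤s e≤n)
                   (λ i i≢e → trans (cong (_* f (n ∸ i)) (mono-≢ e c i≢e)) (ℤP.*-zeroˡ (f (n ∸ i)))))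
        (cong (_* f (n ∸ e)) (mono-≡ e c))

mono-⊛-< : ∀ {e n} c f → n < e → (mono e c ⊛ f) n ≡ 0ℤ
mono-⊛-< {e} {n} c f n<e = Σ<-zero (suc n) λ i i≤n →
  trans (cong (_* f (n ∸ i)) (mono-≢ e c (ℕP.<⇒≢ (ℕP.≤-<-trans (ℕP.≤-pred i≤n) n<e))))
        (ℤP.*-zeroˡ (f (n ∸ i)))

mono-⊛-mono : ∀ a b c d → mono a c ⊛ mono b d ≈ mono (a ℕ.+ b) (c * d)
mono-⊛-mono a b c d = mk≈ coeff-eq
  where
  open ≡-Reasoning
  coeff-eq : ∀ n → (mono a c ⊛ mono b d) n ≡ mono (a ℕ.+ b) (c * d) n
  coeff-eq n with a ℕ.≤? n
  ... | no a≰n  = trans (mono-⊛-< c (mono b d) (ℕP.≰⇒> a≰n))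
                        (sym (mono-≢ (a ℕ.+ b) (c * d) λ n≡a+b →
                                a≰n (ℕP.m+n≤o⇒m≤o a (ℕP.≤-reflexive (sym n≡a+b)))))
  ... | yes a≤n = begin
    (mono a c ⊛ mono b d) n                 ≡⟨ mono-⊛-≥ c (mono b d) a≤n ⟩
    c * mono b d (n ∸ a)                    ≡⟨ *-mono c b d (n ∸ a) ⟩
    mono b (c * d) (n ∸ a)                  ≡⟨ mono-shift a b (c * d) (n ∸ a) ⟨
    mono (a ℕ.+ b) (c * d) (a ℕ.+ (n ∸ a))  ≡⟨ cong (mono (a ℕ.+ b) (c * d)) (ℕP.m+[n∸m]≡n a≤n) ⟩
    mono (a ℕ.+ b) (c * d) n                ∎

X^-+ : ∀ a b → X^ a ⊛ X^ b ≈ X^ (a ℕ.+ b)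
X^-+ a b = mono-⊛-mono a b 1ℤ 1ℤ

X^0 : X^ 0 ≈ one
X^0 = mk≈ λ { zero → refl ; (suc _) → refl }

mono≈const⊛X^ : ∀ e c → mono e c ≈ const c ⊛ X^ e
mono≈const⊛X^ e c = ≈-sym (≈-trans (const-⊛ c (X^ e)) (mk≈ λ n →
  trans (*-mono c e 1ℤ n) (cong (λ c′ → mono e c′ n) (ℤP.*-identityʳ c))))

X^-idx : ∀ {a b} → a ≡ b → X^ a ≈ X^ b
X^-idx refl = ≈-refl

Ord≥ : ℕ → Series → Set
Ord≥ v f = ∀ n → n < v → f n ≡ 0ℤ

Ord≥-0 : ∀ f → Ord≥ 0 f
Ord≥-0 f n ()

Ord≥-weaken : ∀ {v w f} → w ≤ v → Ord≥ v f → Ord≥ w f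
Ord≥-weaken w≤v ord n n<w = ord n (ℕP.<-≤-trans n<w w≤v)

Ord≥-≈ : ∀ {v f g} → f ≈ g → Ord≥ v f → Ord≥ v g
Ord≥-≈ f≈g ord n n<v = trans (sym (coeff f≈g n)) (ord n n<v)

Ord≥-⊕ : ∀ {v f g} → Ord≥ v f → Ord≥ v g → Ord≥ v (f ⊕ g)
Ord≥-⊕ ord-f ord-g n n<v = cong₂ _+_ (ord-f n n<v) (ord-g n n<v)

Ord≥-neg : ∀ {v f} → Ord≥ v f → Ord≥ v (neg f)
Ord≥-neg ord n n<v = cong -_ (ord n n<v)

Ord≥-· : ∀ {v f} c → Ord≥ v f → Ord≥ v (c · f)
Ord≥-· c ord n n<v = trans (cong (c *_) (ord n n<v)) (ℤP.*-zeroʳ c)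

Ord≥-ΣS< : ∀ {v} m (F : ℕ → Series) → (∀ i → Ord≥ v (F i)) → Ord≥ v (ΣS< m F)
Ord≥-ΣS< zero    F ord n _ = refl
Ord≥-ΣS< (suc m) F ord     = Ord≥-⊕ (Ord≥-ΣS< m F ord) (ord m)

Ord≥-mono : ∀ e c → Ord≥ e (mono e c)
Ord≥-mono e c n n<e = mono-≢ e c (ℕP.<⇒≢ n<e)

Ord≥-⊛ : ∀ {a b f g} → Ord≥ a f → Ord≥ b g → Ord≥ (a ℕ.+ b) (f ⊛ g)
Ord≥-⊛ {a} {b} {f} {g} ord-f ord-g n n<a+b = Σ<-zero (suc n) term≡0
  where
  term≡0 : ∀ i → i < suc n → f i * g (n ∸ i) ≡ 0ℤ
  term≡0 i i≤n with i ℕ.<? a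
  ... | yes i<a = trans (cong (_* g (n ∸ i)) (ord-f i i<a)) (ℤP.*-zeroˡ (g (n ∸ i)))
  ... | no i≮a  = trans (cong (f i *_) (ord-g (n ∸ i) n∸i<b)) (ℤP.*-zeroʳ (f i))
    where
    n∸i<b : n ∸ i < b
    n∸i<b = ℕP.+-cancelˡ-< i _ _ (ℕP.<-≤-trans
              (subst (_< a ℕ.+ b) (sym (ℕP.m+[n∸m]≡n (ℕP.≤-pred i≤n))) n<a+b)
              (ℕP.+-monoˡ-≤ b (ℕP.≮⇒≥ i≮a)))

invPrefix-suc : ∀ f N i → i ≤ N → invPrefix f (suc N) i ≡ invPrefix f N i
invPrefix-suc f N i i≤N with i ≟ suc N
... | yes i≡1+N = ⊥-elim (ℕP.<-irrefl i≡1+N (s≤s i≤N))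
... | no _      = refl

invPrefix-top : ∀ f N →
  invPrefix f (suc N) (suc N) ≡ - Σ< (suc N) (λ i → f (suc i) * invPrefix f N (N ∸ i))
invPrefix-top f N with suc N ≟ suc N
... | yes _ = refl
... | no 1+N≢1+N = ⊥-elim (1+N≢1+N refl)

inv≡invPrefix : ∀ f {N i} → i ≤ N → inv f i ≡ invPrefix f N i
inv≡invPrefix f {zero} z≤n = refl
inv≡invPrefix f {suc N} {i} i≤1+N with ℕP.m≤n⇒m<n∨m≡n i≤1+N
... | inj₂ refl      = refl
... | inj₁ (s≤s i≤N) = trans (inv≡invPrefix f i≤N) (sym (invPrefix-suc f N i i≤N))

⊛-inverseʳ : ∀ f → f 0 ≡ 1ℤ → f ⊛ inv f ≈ one
⊛-inverseʳ f f0≡1 = mk≈ coeff-eq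
  where
  open ≡-Reasoning
  coeff-eq : ∀ n → (f ⊛ inv f) n ≡ one n
  coeff-eq zero    = trans (ℤP.+-identityˡ _) (cong (_* 1ℤ) f0≡1)
  coeff-eq (suc N) = begin
    Σ< (suc (suc N)) (λ i → f i * inv f (suc N ∸ i))
      ≡⟨ Σ<-unconsˡ (suc N) _ ⟩
    f 0 * inv f (suc N) + Σ< (suc N) (λ i → f (suc i) * inv f (N ∸ i))
      ≡⟨ cong₂ _+_ (cong₂ _*_ f0≡1 (invPrefix-top f N))
                   (Σ<-cong (suc N) (λ i → cong (f (suc i) *_) (inv≡invPrefix f (ℕP.m∸n≤m N i)))) ⟩
    1ℤ * - S + S  ≡⟨ cong (_+ S) (ℤP.*-identityˡ (- S)) ⟩
    - S + S       ≡⟨ ℤP.+-inverseˡ S ⟩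
    0ℤ            ∎
    where
    S = Σ< (suc N) (λ i → f (suc i) * invPrefix f N (N ∸ i))

inverse-peel : ∀ F G J K → F ⊛ J ≈ one → (F ⊛ G) ⊛ K ≈ one → J ≈ G ⊛ K
inverse-peel F G J K FJ≈1 FGK≈1 = begin
  J                   ≈⟨ ⊛-identityʳ J ⟨
  J ⊛ one             ≈⟨ ⊛-congˡ J FGK≈1 ⟨
  J ⊛ ((F ⊛ G) ⊛ K)   ≈⟨ solve 4 (λ F G J K → J :* ((F :* G) :* K) := (F :* J) :* (G :* K)) ≈-refl F G J K ⟩
  (F ⊛ J) ⊛ (G ⊛ K)   ≈⟨ ⊛-congʳ (G ⊛ K) FJ≈1 ⟩
  one ⊛ (G ⊛ K)       ≈⟨ ⊛-identityˡ (G ⊛ K) ⟩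
  G ⊛ K               ∎
  where open ≈-Reasoning

ΣS<-coeff : ∀ n (F : ℕ → Series) N → ΣS< n F N ≡ Σ< n (λ i → F i N)
ΣS<-coeff zero    F N = refl
ΣS<-coeff (suc n) F N = cong (_+ F n N) (ΣS<-coeff n F N)

ΣS<-cong : ∀ n {F G : ℕ → Series} → (∀ i → F i ≈ G i) → ΣS< n F ≈ ΣS< n G
ΣS<-cong zero    F≈G = ≈-refl
ΣS<-cong (suc n) F≈G = ⊕-cong (ΣS<-cong n F≈G) (F≈G n)

⊛-distribˡ-ΣS< : ∀ n f (F : ℕ → Series) → f ⊛ ΣS< n F ≈ ΣS< n (λ i → f ⊛ F i)
⊛-distribˡ-ΣS< zero    f F = ⊛-zeroʳ f
⊛-distribˡ-ΣS< (suc n) f F =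
  ≈-trans (⊛-distribˡ-⊕ f (ΣS< n F) (F n)) (⊕-congʳ (f ⊛ F n) (⊛-distribˡ-ΣS< n f F))

ΠS<-cong : ∀ n {F G : ℕ → Series} → (∀ i → F i ≈ G i) → ΠS< n F ≈ ΠS< n G
ΠS<-cong zero    F≈G = ≈-refl
ΠS<-cong (suc n) F≈G = ⊛-cong (ΠS<-cong n F≈G) (F≈G n)

ΠS<-constant-term : ∀ n (F : ℕ → Series) → (∀ r → F r 0 ≡ 1ℤ) → ΠS< n F 0 ≡ 1ℤ
ΠS<-constant-term zero    F F0≡1 = refl
ΠS<-constant-term (suc n) F F0≡1 = trans (ℤP.+-identityˡ _) (cong₂ _*_ (ΠS<-constant-term n F F0≡1) (F0≡1 n))

record Summable (u : ℕ → Series) : Set where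
  constructor summable
  field term-ord : ∀ i → Ord≥ i (u i)

open Summable

Summable-suc : ∀ {u} → Summable u → Summable (u ∘ suc)
Summable-suc s = summable λ i → Ord≥-weaken (ℕP.n≤1+n i) (term-ord s (suc i))

Summable-drop : ∀ k {u} → Summable u → Summable (λ i → u (k ℕ.+ i))
Summable-drop k s = summable λ i → Ord≥-weaken (ℕP.m≤n+m i k) (term-ord s (k ℕ.+ i))

-- Meaningful for summable families, whose terms with i > N do not reach q^N.
Σ∞ : (ℕ → Series) → Series
Σ∞ u N = Σ< (suc N) (λ i → u i N)

ΣS<≡Σ∞ : ∀ {u} → Summable u → ∀ {J N} → N < J → ΣS< J u N ≡ Σ∞ u N
ΣS<≡Σ∞ {u} s {J} {N} N<J =
  trans (ΣS<-coeff J u N) (Σ<-extend (λ i → u i N) N<J (λ i N<i → term-ord s i N N<i))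

Σ∞-cong : ∀ {u v} → (∀ i → u i ≈ v i) → Σ∞ u ≈ Σ∞ v
Σ∞-cong u≈v = mk≈ λ N → Σ<-cong (suc N) (λ i → coeff (u≈v i) N)

Σ∞-distrib-⊕ : ∀ u v → Σ∞ (λ i → u i ⊕ v i) ≈ Σ∞ u ⊕ Σ∞ v
Σ∞-distrib-⊕ u v = mk≈ λ N → Σ<-distrib-+ (suc N) (λ i → u i N) (λ i → v i N)

Σ∞-neg : ∀ u → Σ∞ (λ i → neg (u i)) ≈ neg (Σ∞ u)
Σ∞-neg u = mk≈ λ N → sym (neg-distrib-Σ< (suc N) (λ i → u i N))

Σ∞-· : ∀ c u → Σ∞ (λ i → c · u i) ≈ c · Σ∞ u
Σ∞-· c u = mk≈ λ N → sym (*-distribˡ-Σ< (suc N) c (λ i → u i N))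

⊛-distribˡ-Σ∞ : ∀ f {u} → Summable u → f ⊛ Σ∞ u ≈ Σ∞ (λ i → f ⊛ u i)
⊛-distribˡ-Σ∞ f {u} s = mk≈ λ N → begin
  Σ< (suc N) (λ a → f a * Σ< (suc (N ∸ a)) (λ i → u i (N ∸ a)))
    ≡⟨ Σ<-cong (suc N) (λ a → cong (f a *_) (Σ<-extend (λ i → u i (N ∸ a))
         (s≤s (ℕP.m∸n≤m N a)) (λ i N∸a<i → term-ord s i (N ∸ a) N∸a<i))) ⟨
  Σ< (suc N) (λ a → f a * Σ< (suc N) (λ i → u i (N ∸ a)))
    ≡⟨ Σ<-cong (suc N) (λ a → *-distribˡ-Σ< (suc N) (f a) (λ i → u i (N ∸ a))) ⟩
  Σ< (suc N) (λ a → Σ< (suc N) (λ i → f a * u i (N ∸ a)))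
    ≡⟨ Σ<-comm (suc N) (suc N) (λ a i → f a * u i (N ∸ a)) ⟩
  Σ< (suc N) (λ i → Σ< (suc N) (λ a → f a * u i (N ∸ a))) ∎
  where open ≡-Reasoning

Σ∞-⊕-⊛ : ∀ {u t} a → Summable t → Σ∞ (λ b → u b ⊕ a ⊛ t b) ≈ Σ∞ u ⊕ a ⊛ Σ∞ t
Σ∞-⊕-⊛ {u} {t} a s =
  ≈-trans (Σ∞-distrib-⊕ u (λ b → a ⊛ t b)) (⊕-congˡ (Σ∞ u) (≈-sym (⊛-distribˡ-Σ∞ a s)))

Σ∞-unconsˡ : ∀ {u} → Summable u → Σ∞ u ≈ u 0 ⊕ Σ∞ (u ∘ suc)
Σ∞-unconsˡ {u} s = mk≈ λ N → begin
  Σ< (suc N) (λ i → u i N)                  ≡⟨ Σ<-unconsˡ N _ ⟩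
  u 0 N + Σ< N (λ i → u (suc i) N)          ≡⟨ cong (λ t → u 0 N + t) (Σ<-extend (λ i → u (suc i) N) (ℕP.n≤1+n N)
                                                   (λ i N≤i → term-ord s (suc i) N (s≤s N≤i))) ⟨
  u 0 N + Σ< (suc N) (λ i → u (suc i) N)    ∎
  where open ≡-Reasoning

Σ∞-zero : ∀ {u} → (∀ i → u i ≈ zeroS) → Σ∞ u ≈ zeroS
Σ∞-zero u≈0 = mk≈ λ N → Σ<-zero (suc N) (λ i _ → coeff (u≈0 i) N)

Σ∞-drop : ∀ k {u} → Summable u → (∀ i → i < k → u i ≈ zeroS) → Σ∞ u ≈ Σ∞ (λ i → u (k ℕ.+ i))
Σ∞-drop zero    s _   = ≈-refl
Σ∞-drop (suc k) {u} s u≈0 = begin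
  Σ∞ u                             ≈⟨ Σ∞-unconsˡ s ⟩
  u 0 ⊕ Σ∞ (u ∘ suc)               ≈⟨ ⊕-congʳ (Σ∞ (u ∘ suc)) (u≈0 0 (s≤s z≤n)) ⟩
  zeroS ⊕ Σ∞ (u ∘ suc)             ≈⟨ mk≈ (λ N → ℤP.+-identityˡ _) ⟩
  Σ∞ (u ∘ suc)                     ≈⟨ Σ∞-drop k (Summable-suc s) (λ i i<k → u≈0 (suc i) (s≤s i<k)) ⟩
  Σ∞ (λ i → u (suc k ℕ.+ i))       ∎
  where open ≈-Reasoning

⊛-ΣS<≡⊛-Σ∞ : ∀ f {u} → Summable u → ∀ {J N} → N < J → (f ⊛ ΣS< J u) N ≡ (f ⊛ Σ∞ u) N
⊛-ΣS<≡⊛-Σ∞ f {u} s {J} {N} N<J = begin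
  (f ⊛ ΣS< J u) N                ≡⟨ coeff (⊛-distribˡ-ΣS< J f u) N ⟩
  ΣS< J (λ i → f ⊛ u i) N        ≡⟨ ΣS<≡Σ∞ (summable λ i → Ord≥-⊛ (Ord≥-0 f) (term-ord s i)) N<J ⟩
  Σ∞ (λ i → f ⊛ u i) N           ≡⟨ coeff (⊛-distribˡ-Σ∞ f s) N ⟨
  (f ⊛ Σ∞ u) N                   ∎
  where open ≡-Reasoning

-- Multiplication by (1 - Z t) (1 - Z t⁻¹)

mirrorPred : ℕ → ℕ
mirrorPred zero    = 1
mirrorPred (suc k) = k

-- Coefficient of t^k in (1 - Z t) (1 - Z t⁻¹) Σ_k X_k t^k, for a family extended by X_{-k} = X_k.
mul[1-Zt][1-Z/t] : Series → (ℕ → Series) → ℕ → Series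
mul[1-Zt][1-Z/t] Z X k = (one ⊕ Z ⊛ Z) ⊛ X k ⊕ neg (Z ⊛ (X (suc k) ⊕ X (mirrorPred k)))

mul[1-Zt][1-Z/t]-linear : ∀ Z c X Y k →
  mul[1-Zt][1-Z/t] Z (λ k → X k ⊕ neg (c ⊛ Y k)) k ≈ mul[1-Zt][1-Z/t] Z X k ⊕ neg (c ⊛ mul[1-Zt][1-Z/t] Z Y k)
mul[1-Zt][1-Z/t]-linear Z c X Y k =
  solve 8 (λ Z c X X⁺ X⁻ Y Y⁺ Y⁻ →
    (con 1ℤ :+ Z :* Z) :* (X :- c :* Y) :- Z :* ((X⁺ :- c :* Y⁺) :+ (X⁻ :- c :* Y⁻))
    := ((con 1ℤ :+ Z :* Z) :* X :- Z :* (X⁺ :+ X⁻)) :- c :* ((con 1ℤ :+ Z :* Z) :* Y :- Z :* (Y⁺ :+ Y⁻)))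
    ≈-refl Z c (X k) (X (suc k)) (X (mirrorPred k)) (Y k) (Y (suc k)) (Y (mirrorPred k))

mul[1-Zt][1-Z/t]-injective : ∀ {Z} → Ord≥ 1 Z → ∀ X →
  (∀ k → mul[1-Zt][1-Z/t] Z X k ≈ zeroS) → ∀ k → X k ≈ zeroS
mul[1-Zt][1-Z/t]-injective {Z} ord-Z X mulX≈0 k = mk≈ λ n → ord≥ (suc n) k n ℕP.≤-refl
  where
  X≈Z⊛rest⊕mulX : ∀ k → X k ≈ Z ⊛ (X (suc k) ⊕ X (mirrorPred k) ⊕ neg (Z ⊛ X k)) ⊕ mul[1-Zt][1-Z/t] Z X k
  X≈Z⊛rest⊕mulX k = solve 4 (λ Z X X⁺ X⁻ →
                X := Z :* (X⁺ :+ X⁻ :- Z :* X) :+ ((con 1ℤ :+ Z :* Z) :* X :- Z :* (X⁺ :+ X⁻)))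
              ≈-refl Z (X k) (X (suc k)) (X (mirrorPred k))
  ord≥ : ∀ n k → Ord≥ n (X k)
  ord≥ zero    k = Ord≥-0 (X k)
  ord≥ (suc n) k = Ord≥-≈ (≈-sym (X≈Z⊛rest⊕mulX k))
    (Ord≥-⊕ (Ord≥-⊛ ord-Z (Ord≥-⊕ (Ord≥-⊕ (ord≥ n (suc k)) (ord≥ n (mirrorPred k)))
                                   (Ord≥-neg (Ord≥-weaken (ℕP.n≤1+n n) (Ord≥-⊛ ord-Z (ord≥ n k))))))
            (Ord≥-≈ (≈-sym (mulX≈0 k)) (λ _ _ → refl)))

-- Complete homogeneous symmetric functions

-- h_a(z 0, …, z (m - 1)), the complete homogeneous symmetric function, split by its largest variable.
complete : (ℕ → Series) → ℕ → ℕ → Series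
complete z zero    m = one
complete z (suc a) m = ΣS< m (λ n → z n ⊛ complete z a (suc n))

Ord≥-complete : ∀ {z} → (∀ n → Ord≥ 1 (z n)) → ∀ a m → Ord≥ a (complete z a m)
Ord≥-complete ord-z zero    m = Ord≥-0 one
Ord≥-complete ord-z (suc a) m = Ord≥-ΣS< m _ (λ n → Ord≥-⊛ (ord-z n) (Ord≥-complete ord-z a (suc n)))

module CompletePairs (z : ℕ → Series) (ord-z : ∀ n → Ord≥ 1 (z n)) where

  pairTerm : ℕ → ℕ → ℕ → Series
  pairTerm k m b = complete z (k ℕ.+ b) m ⊛ complete z b m

  -- Σ_b h_{k+b} h_b: the coefficient of t^k in Π_n 1 / ((1 - z_n t) (1 - z_n t⁻¹)).
  B : ℕ → ℕ → Series
  B k m = Σ∞ (pairTerm k m)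

  pairTerm-summable : ∀ k m → Summable (pairTerm k m)
  pairTerm-summable k m = summable λ b → Ord≥-⊛ (Ord≥-0 (complete z (k ℕ.+ b) m)) (Ord≥-complete ord-z b m)

  complete-idx : ∀ {a a′} m → a ≡ a′ → complete z a m ≈ complete z a′ m
  complete-idx m refl = ≈-refl

  B-unconsˡ : ∀ k m → B k m ≈ complete z k m ⊕ Σ∞ (λ b → complete z (suc (k ℕ.+ b)) m ⊛ complete z (suc b) m)
  B-unconsˡ k m = begin
    B k m                                               ≈⟨ Σ∞-unconsˡ (pairTerm-summable k m) ⟩
    complete z (k ℕ.+ 0) m ⊛ one ⊕ Σ∞ (pairTerm k m ∘ suc)
      ≈⟨ ⊕-cong (≈-trans (⊛-identityʳ _) (complete-idx m (ℕP.+-identityʳ k)))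
                (Σ∞-cong (λ b → ⊛-congʳ (complete z (suc b) m) (complete-idx m (ℕP.+-suc k b)))) ⟩
    complete z k m ⊕ Σ∞ (λ b → complete z (suc (k ℕ.+ b)) m ⊛ complete z (suc b) m) ∎
    where open ≈-Reasoning

  B-tail : ∀ k m → Σ∞ (λ b → complete z (suc (k ℕ.+ b)) m ⊛ complete z (suc b) m) ≈ B k m ⊕ neg (complete z k m)
  B-tail k m = ≈-trans (solve 2 (λ T G → T := (G :+ T) :- G) ≈-refl _ (complete z k m))
                       (⊕-congʳ (neg (complete z k m)) (≈-sym (B-unconsˡ k m)))

  module _ (m : ℕ) where
    private
      Z = z m
      g  = λ a → complete z a (suc m)
      g′ = λ a → complete z a m

    g′-suc : ∀ a → g′ (suc a) ≈ g (suc a) ⊕ neg (Z ⊛ g a)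
    g′-suc a = solve 2 (λ G′ ZG → G′ := (G′ :+ ZG) :- ZG) ≈-refl (g′ (suc a)) (Z ⊛ g a)

    B-expand : ∀ k → B k m ≈
      g′ k ⊕ (Σ∞ (λ b → g (suc (k ℕ.+ b)) ⊛ g (suc b))
              ⊕ neg Z ⊛ Σ∞ (λ b → g (k ℕ.+ b) ⊛ g (suc b))
              ⊕ neg Z ⊛ B (suc k) (suc m)
              ⊕ (Z ⊛ Z) ⊛ B k (suc m))
    B-expand k = begin
      B k m
        ≈⟨ B-unconsˡ k m ⟩
      g′ k ⊕ Σ∞ (λ b → g′ (suc (k ℕ.+ b)) ⊛ g′ (suc b))
        ≈⟨ ⊕-congˡ (g′ k) (Σ∞-cong λ b → ≈-trans (⊛-cong (g′-suc (k ℕ.+ b)) (g′-suc b))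
             (solve 5 (λ Gkb₊ Gkb Gb₊ Gb Z → (Gkb₊ :- Z :* Gkb) :* (Gb₊ :- Z :* Gb)
                  := Gkb₊ :* Gb₊ :+ (:- Z) :* (Gkb :* Gb₊) :+ (:- Z) :* (Gkb₊ :* Gb) :+ (Z :* Z) :* (Gkb :* Gb))
                ≈-refl (g (suc (k ℕ.+ b))) (g (k ℕ.+ b)) (g (suc b)) (g b) Z)) ⟩
      g′ k ⊕ Σ∞ (λ b → g (suc (k ℕ.+ b)) ⊛ g (suc b) ⊕ neg Z ⊛ (g (k ℕ.+ b) ⊛ g (suc b))
                       ⊕ neg Z ⊛ pairTerm (suc k) (suc m) b ⊕ (Z ⊛ Z) ⊛ pairTerm k (suc m) b)
        ≈⟨ ⊕-congˡ (g′ k) (≈-trans (Σ∞-⊕-⊛ (Z ⊛ Z) (pairTerm-summable k (suc m)))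
             (⊕-congʳ _ (≈-trans (Σ∞-⊕-⊛ (neg Z) (pairTerm-summable (suc k) (suc m)))
               (⊕-congʳ _ (Σ∞-⊕-⊛ (neg Z) cross-summable))))) ⟩
      g′ k ⊕ (Σ∞ (λ b → g (suc (k ℕ.+ b)) ⊛ g (suc b))
              ⊕ neg Z ⊛ Σ∞ (λ b → g (k ℕ.+ b) ⊛ g (suc b))
              ⊕ neg Z ⊛ B (suc k) (suc m)
              ⊕ (Z ⊛ Z) ⊛ B k (suc m)) ∎
      where
      open ≈-Reasoning
      cross-summable : Summable (λ b → g (k ℕ.+ b) ⊛ g (suc b))
      cross-summable = summable λ b → Ord≥-weaken (ℕP.n≤1+n b)
        (Ord≥-⊛ (Ord≥-0 (g (k ℕ.+ b))) (Ord≥-complete ord-z (suc b) (suc m)))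

    B-recurrence : ∀ k → mul[1-Zt][1-Z/t] Z (λ k → B k (suc m)) k ≈ B k m
    B-recurrence zero = ≈-sym (begin
      B 0 m
        ≈⟨ B-expand 0 ⟩
      one ⊕ (X₁ ⊕ neg Z ⊛ X₂ ⊕ neg Z ⊛ B₁ ⊕ (Z ⊛ Z) ⊛ B₀)
        ≈⟨ ⊕-congˡ one (⊕-congʳ ((Z ⊛ Z) ⊛ B₀) (⊕-congʳ (neg Z ⊛ B₁)
             (⊕-cong (B-tail 0 (suc m)) (⊛-congˡ (neg Z) (Σ∞-cong λ b → ⊛-comm (g b) (g (suc b))))))) ⟩
      one ⊕ ((B₀ ⊕ neg one) ⊕ neg Z ⊛ B₁ ⊕ neg Z ⊛ B₁ ⊕ (Z ⊛ Z) ⊛ B₀)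
        ≈⟨ solve 3 (λ B₀ B₁ Z → con 1ℤ :+ ((B₀ :- con 1ℤ) :+ (:- Z) :* B₁ :+ (:- Z) :* B₁ :+ (Z :* Z) :* B₀)
                              := (con 1ℤ :+ Z :* Z) :* B₀ :- Z :* (B₁ :+ B₁)) ≈-refl B₀ B₁ Z ⟩
      mul[1-Zt][1-Z/t] Z (λ k → B k (suc m)) 0 ∎)
      where
      open ≈-Reasoning
      B₀ = B 0 (suc m)
      B₁ = B 1 (suc m)
      X₁ = Σ∞ (λ b → g (suc b) ⊛ g (suc b))
      X₂ = Σ∞ (λ b → g b ⊛ g (suc b))
    B-recurrence (suc K) = ≈-sym (begin
      B k m
        ≈⟨ B-expand k ⟩
      g′ k ⊕ (X₁ ⊕ neg Z ⊛ X₂ ⊕ neg Z ⊛ B₊ ⊕ (Z ⊛ Z) ⊛ Bₖ)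
        ≈⟨ ⊕-cong (g′-suc K) (⊕-congʳ ((Z ⊛ Z) ⊛ Bₖ) (⊕-congʳ (neg Z ⊛ B₊)
             (⊕-cong (B-tail k (suc m)) (⊛-congˡ (neg Z) (B-tail K (suc m)))))) ⟩
      (g k ⊕ neg (Z ⊛ g K)) ⊕ ((Bₖ ⊕ neg (g k)) ⊕ neg Z ⊛ (B₋ ⊕ neg (g K)) ⊕ neg Z ⊛ B₊ ⊕ (Z ⊛ Z) ⊛ Bₖ)
        ≈⟨ solve 6 (λ Gk GK Bₖ B₋ B₊ Z →
             (Gk :- Z :* GK) :+ ((Bₖ :- Gk) :+ (:- Z) :* (B₋ :- GK) :+ (:- Z) :* B₊ :+ (Z :* Z) :* Bₖ)
             := (con 1ℤ :+ Z :* Z) :* Bₖ :- Z :* (B₊ :+ B₋)) ≈-refl (g k) (g K) Bₖ B₋ B₊ Z ⟩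
      mul[1-Zt][1-Z/t] Z (λ k → B k (suc m)) k ∎)
      where
      open ≈-Reasoning
      k = suc K
      Bₖ = B k (suc m)
      B₊ = B (suc k) (suc m)
      B₋ = B K (suc m)
      X₁ = Σ∞ (λ b → g (suc (k ℕ.+ b)) ⊛ g (suc b))
      X₂ = Σ∞ (λ b → g (k ℕ.+ b) ⊛ g (suc b))

-- The coefficient of t^k, and of t^{-k}, in (t - 2ε + t⁻¹)^j.
α : ℤ → ℕ → ℕ → ℤ
α ε zero    zero    = 1ℤ
α ε zero    (suc k) = 0ℤ
α ε (suc j) k       = α ε j (suc k) + α ε j (mirrorPred k) - (+ 2 * ε) * α ε j k

module CompleteSums (x : ℕ → Series) (ord-x : ∀ n → Ord≥ 1 (x n)) where

  weightedTerm : (ℕ → ℤ) → ℕ → ℕ → Series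
  weightedTerm c m j = c j · complete x j m

  Σcomplete : (ℕ → ℤ) → ℕ → Series
  Σcomplete c m = Σ∞ (weightedTerm c m)

  Σcomplete-summable : ∀ c m → Summable (weightedTerm c m)
  Σcomplete-summable c m = summable λ j → Ord≥-· (c j) (Ord≥-complete ord-x j m)

  Σcomplete-suc : ∀ c m → Σcomplete c (suc m) ≈ Σcomplete c m ⊕ x m ⊛ Σcomplete (c ∘ suc) (suc m)
  Σcomplete-suc c m = begin
    Σcomplete c (suc m)
      ≈⟨ Σ∞-unconsˡ (Σcomplete-summable c (suc m)) ⟩
    c 0 · one ⊕ Σ∞ (λ j → c (suc j) · (complete x (suc j) m ⊕ x m ⊛ complete x j (suc m)))
      ≈⟨ ⊕-congˡ (c 0 · one) (Σ∞-cong λ j → split (c (suc j)) (complete x (suc j) m) (complete x j (suc m))) ⟩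
    c 0 · one ⊕ Σ∞ (λ j → c (suc j) · complete x (suc j) m ⊕ x m ⊛ (c (suc j) · complete x j (suc m)))
      ≈⟨ ⊕-congˡ (c 0 · one) (Σ∞-⊕-⊛ (x m) (Σcomplete-summable (c ∘ suc) (suc m))) ⟩
    c 0 · one ⊕ (Σ∞ (λ j → c (suc j) · complete x (suc j) m) ⊕ x m ⊛ Σcomplete (c ∘ suc) (suc m))
      ≈⟨ solve 3 (λ a b c → a :+ (b :+ c) := (a :+ b) :+ c) ≈-refl (c 0 · one) _ _ ⟩
    (c 0 · one ⊕ Σ∞ (λ j → c (suc j) · complete x (suc j) m)) ⊕ x m ⊛ Σcomplete (c ∘ suc) (suc m)
      ≈⟨ ⊕-congʳ _ (Σ∞-unconsˡ (Σcomplete-summable c m)) ⟨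
    Σcomplete c m ⊕ x m ⊛ Σcomplete (c ∘ suc) (suc m) ∎
    where
    open ≈-Reasoning
    split : ∀ a f h → a · (f ⊕ x m ⊛ h) ≈ a · f ⊕ x m ⊛ (a · h)
    split a f h = begin
      a · (f ⊕ x m ⊛ h)              ≈⟨ const-⊛ a _ ⟨
      const a ⊛ (f ⊕ x m ⊛ h)
        ≈⟨ solve 4 (λ A f y h → A :* (f :+ y :* h) := A :* f :+ y :* (A :* h)) ≈-refl (const a) f (x m) h ⟩
      const a ⊛ f ⊕ x m ⊛ (const a ⊛ h)  ≈⟨ ⊕-cong (const-⊛ a f) (⊛-congˡ (x m) (const-⊛ a h)) ⟩
      a · f ⊕ x m ⊛ (a · h)          ∎

  Σcomplete-combination : ∀ a b c d m →
    Σcomplete (λ j → a j + b j - c * d j) m ≈ Σcomplete a m ⊕ Σcomplete b m ⊕ neg (c · Σcomplete d m)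
  Σcomplete-combination a b c d m = begin
    Σcomplete (λ j → a j + b j - c * d j) m
      ≈⟨ Σ∞-cong (λ j → mk≈ λ n → distrib (a j) (b j) c (d j) (complete x j m n)) ⟩
    Σ∞ (λ j → a j · h j ⊕ b j · h j ⊕ neg (c · (d j · h j)))
      ≈⟨ Σ∞-distrib-⊕ _ _ ⟩
    Σ∞ (λ j → a j · h j ⊕ b j · h j) ⊕ Σ∞ (λ j → neg (c · (d j · h j)))
      ≈⟨ ⊕-cong (Σ∞-distrib-⊕ _ _) (≈-trans (Σ∞-neg _) (neg-cong (Σ∞-· c _))) ⟩
    Σcomplete a m ⊕ Σcomplete b m ⊕ neg (c · Σcomplete d m) ∎
    where
    open ≈-Reasoning
    h = λ j → complete x j m
    distrib : ∀ a b c d y → (a + b - c * d) * y ≡ a * y + b * y + - (c * (d * y))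
    distrib = ℤ-Solver.solve-∀

-- The product formula

module ProductFormula
  (ε : ℤ) (ε²≡1 : ε * ε ≡ 1ℤ) (x z : ℕ → Series)
  (ord-x : ∀ n → Ord≥ 1 (x n)) (ord-z : ∀ n → Ord≥ 1 (z n))
  (x⊛L²≈z : ∀ n → x n ⊛ ((one ⊕ neg (const ε ⊛ z n)) ⊛ (one ⊕ neg (const ε ⊛ z n))) ≈ z n)
  where

  open CompleteSums x ord-x
  open CompletePairs z ord-z

  E : Series
  E = const ε

  L : ℕ → Series
  L n = one ⊕ neg (E ⊛ z n)

  P : ℕ → Series
  P m = ΠS< m L

  A : ℕ → ℕ → Series
  A k m = Σcomplete (λ j → α ε j k) m

  E⊛E≈one : E ⊛ E ≈ one
  E⊛E≈one = ≈-trans (const-⊛ ε E) (mk≈ λ { zero → ε²≡1 ; (suc n) → ℤP.*-zeroʳ ε })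

  -- 1 + Z² = (1 - εZ)² + 2εZ, as ε² = 1
  [1+Z²]a-Zb≈L²a-Z[b-2εa] : ∀ n a b →
    (one ⊕ z n ⊛ z n) ⊛ a ⊕ neg (z n ⊛ b) ≈ (L n ⊛ L n) ⊛ a ⊕ neg (z n ⊛ (b ⊕ neg ((+ 2 * ε) · a)))
  [1+Z²]a-Zb≈L²a-Z[b-2εa] n a b = begin
    (one ⊕ Z ⊛ Z) ⊛ a ⊕ neg (Z ⊛ b)
      ≈⟨ ⊕-congʳ (neg (Z ⊛ b)) (⊛-congʳ a (⊕-congˡ one
           (≈-trans (⊛-congʳ (Z ⊛ Z) E⊛E≈one) (⊛-identityˡ (Z ⊛ Z))))) ⟨
    (one ⊕ (E ⊛ E) ⊛ (Z ⊛ Z)) ⊛ a ⊕ neg (Z ⊛ b)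
      ≈⟨ solve 4 (λ E Z a b → (con 1ℤ :+ (E :* E) :* (Z :* Z)) :* a :- Z :* b
                            := (con 1ℤ :- E :* Z) :* (con 1ℤ :- E :* Z) :* a :- Z :* (b :- (E :+ E) :* a))
           ≈-refl E Z a b ⟩
    (L n ⊛ L n) ⊛ a ⊕ neg (Z ⊛ (b ⊕ neg ((E ⊕ E) ⊛ a)))
      ≈⟨ ⊕-congˡ ((L n ⊛ L n) ⊛ a) (neg-cong (⊛-congˡ Z (⊕-congˡ b (neg-cong
           (≈-trans (⊛-congʳ a 2E≈E⊕E) (const-⊛ (+ 2 * ε) a)))))) ⟩
    (L n ⊛ L n) ⊛ a ⊕ neg (Z ⊛ (b ⊕ neg ((+ 2 * ε) · a))) ∎
    where
    open ≈-Reasoning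
    Z = z n
    2E≈E⊕E : E ⊕ E ≈ const (+ 2 * ε)
    2E≈E⊕E = mk≈ λ { zero → double ε ; (suc n) → refl }
      where
      double : ∀ e → e + e ≡ + 2 * e
      double = ℤ-Solver.solve-∀

  A-suc : ∀ k m → A k (suc m) ≈
    A k m ⊕ x m ⊛ (A (suc k) (suc m) ⊕ A (mirrorPred k) (suc m) ⊕ neg ((+ 2 * ε) · A k (suc m)))
  A-suc k m = ≈-trans (Σcomplete-suc (λ j → α ε j k) m)
    (⊕-congˡ (A k m) (⊛-congˡ (x m)
      (Σcomplete-combination (λ j → α ε j (suc k)) (λ j → α ε j (mirrorPred k)) (+ 2 * ε) (λ j → α ε j k) (suc m))))

  A-recurrence : ∀ m k → mul[1-Zt][1-Z/t] (z m) (λ k → A k (suc m)) k ≈ (L m ⊛ L m) ⊛ A k m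
  A-recurrence m k = begin
    mul[1-Zt][1-Z/t] Z (λ k → A k (suc m)) k
      ≈⟨ [1+Z²]a-Zb≈L²a-Z[b-2εa] m (A k (suc m)) (A (suc k) (suc m) ⊕ A (mirrorPred k) (suc m)) ⟩
    (L m ⊛ L m) ⊛ A k (suc m) ⊕ neg (Z ⊛ S)
      ≈⟨ ⊕-congʳ (neg (Z ⊛ S)) (⊛-congˡ (L m ⊛ L m) (A-suc k m)) ⟩
    (L m ⊛ L m) ⊛ (A k m ⊕ x m ⊛ S) ⊕ neg (Z ⊛ S)
      ≈⟨ solve 5 (λ L² A x S Z → L² :* (A :+ x :* S) :- Z :* S := L² :* A :+ ((x :* L²) :* S :- Z :* S))
           ≈-refl (L m ⊛ L m) (A k m) (x m) S Z ⟩
    (L m ⊛ L m) ⊛ A k m ⊕ ((x m ⊛ (L m ⊛ L m)) ⊛ S ⊕ neg (Z ⊛ S))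
      ≈⟨ ⊕-congˡ ((L m ⊛ L m) ⊛ A k m) (⊕-congʳ (neg (Z ⊛ S)) (⊛-congʳ S (x⊛L²≈z m))) ⟩
    (L m ⊛ L m) ⊛ A k m ⊕ (Z ⊛ S ⊕ neg (Z ⊛ S))
      ≈⟨ solve 2 (λ a b → a :+ (b :- b) := a) ≈-refl ((L m ⊛ L m) ⊛ A k m) (Z ⊛ S) ⟩
    (L m ⊛ L m) ⊛ A k m ∎
    where
    open ≈-Reasoning
    Z = z m
    S = A (suc k) (suc m) ⊕ A (mirrorPred k) (suc m) ⊕ neg ((+ 2 * ε) · A k (suc m))

  A-zero : ∀ k → A k 0 ≈ complete z k 0
  A-zero k = begin
    A k 0                    ≈⟨ Σ∞-unconsˡ (Σcomplete-summable (λ j → α ε j k) 0) ⟩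
    α ε 0 k · one ⊕ Σ∞ (λ j → α ε (suc j) k · zeroS)
      ≈⟨ ⊕-congˡ (α ε 0 k · one) (Σ∞-zero (λ j → mk≈ λ n → ℤP.*-zeroʳ (α ε (suc j) k))) ⟩
    α ε 0 k · one ⊕ zeroS    ≈⟨ mk≈ (λ n → ℤP.+-identityʳ _) ⟩
    α ε 0 k · one            ≈⟨ δ k ⟩
    complete z k 0           ∎
    where
    open ≈-Reasoning
    δ : ∀ k → α ε 0 k · one ≈ complete z k 0
    δ zero    = mk≈ λ n → ℤP.*-identityˡ (one n)
    δ (suc k) = mk≈ λ n → refl

  B-zero : ∀ k → B k 0 ≈ complete z k 0
  B-zero k = begin
    B k 0   ≈⟨ B-unconsˡ k 0 ⟩
    complete z k 0 ⊕ Σ∞ (λ b → zeroS ⊛ zeroS)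
      ≈⟨ ⊕-congˡ (complete z k 0) (Σ∞-zero (λ b → ⊛-zeroʳ zeroS)) ⟩
    complete z k 0 ⊕ zeroS                      ≈⟨ mk≈ (λ n → ℤP.+-identityʳ _) ⟩
    complete z k 0 ∎
    where open ≈-Reasoning

  A≈P²B : ∀ m k → A k m ≈ (P m ⊛ P m) ⊛ B k m
  A≈P²B zero k = begin
    A k 0                  ≈⟨ A-zero k ⟩
    complete z k 0         ≈⟨ B-zero k ⟨
    B k 0                  ≈⟨ solve 1 (λ B → B := (con 1ℤ :* con 1ℤ) :* B) ≈-refl (B k 0) ⟩
    (one ⊛ one) ⊛ B k 0    ∎
    where open ≈-Reasoning
  A≈P²B (suc m) = λ k → ⊕-neg≈zero⇒≈ (mul[1-Zt][1-Z/t]-injective (ord-z m) D mulD≈0 k)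
    where
    Q = P (suc m) ⊛ P (suc m)
    D : ℕ → Series
    D k = A k (suc m) ⊕ neg (Q ⊛ B k (suc m))
    mulD≈0 : ∀ k → mul[1-Zt][1-Z/t] (z m) D k ≈ zeroS
    mulD≈0 k = begin
      mul[1-Zt][1-Z/t] (z m) D k
        ≈⟨ mul[1-Zt][1-Z/t]-linear (z m) Q (λ k → A k (suc m)) (λ k → B k (suc m)) k ⟩
      mul[1-Zt][1-Z/t] (z m) (λ k → A k (suc m)) k ⊕ neg (Q ⊛ mul[1-Zt][1-Z/t] (z m) (λ k → B k (suc m)) k)
        ≈⟨ ⊕-cong (A-recurrence m k) (neg-cong (⊛-congˡ Q (B-recurrence m k))) ⟩
      (L m ⊛ L m) ⊛ A k m ⊕ neg (Q ⊛ B k m)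
        ≈⟨ ⊕-congʳ (neg (Q ⊛ B k m)) (⊛-congˡ (L m ⊛ L m) (A≈P²B m k)) ⟩
      (L m ⊛ L m) ⊛ ((P m ⊛ P m) ⊛ B k m) ⊕ neg (((P m ⊛ L m) ⊛ (P m ⊛ L m)) ⊛ B k m)
        ≈⟨ solve 3 (λ L P B → (L :* L) :* ((P :* P) :* B) :- ((P :* L) :* (P :* L)) :* B := con 0ℤ)
             ≈-refl (L m) (P m) (B k m) ⟩
      const 0ℤ
        ≈⟨ mk≈ (λ { zero → refl ; (suc n) → refl }) ⟩
      zeroS ∎
      where open ≈-Reasoning

double-pascal : ∀ n r → suc (suc n) C suc (suc r) ≡ (n C r ℕ.+ n C suc r) ℕ.+ (n C suc r ℕ.+ n C suc (suc r))
double-pascal n r = begin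
  suc (suc n) C suc (suc r)                   ≡⟨ nCk+nC[k+1]≡[n+1]C[k+1] (suc n) (suc r) ⟨
  suc n C suc r ℕ.+ suc n C suc (suc r)
    ≡⟨ cong₂ ℕ._+_ (nCk+nC[k+1]≡[n+1]C[k+1] n r) (nCk+nC[k+1]≡[n+1]C[k+1] n (suc r)) ⟨
  (n C r ℕ.+ n C suc r) ℕ.+ (n C suc r ℕ.+ n C suc (suc r)) ∎
  where open ≡-Reasoning

central-pascal : ∀ j → suc (suc (2 ℕ.* j)) C suc j ≡
  (2 ℕ.* j C j ℕ.+ 2 ℕ.* j C suc j) ℕ.+ (2 ℕ.* j C j ℕ.+ 2 ℕ.* j C suc j)
central-pascal j = begin
  suc (suc n) C suc j                   ≡⟨ nCk+nC[k+1]≡[n+1]C[k+1] (suc n) j ⟨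
  suc n C j ℕ.+ suc n C suc j           ≡⟨ cong (ℕ._+ suc n C suc j) symmetric ⟩
  suc n C suc j ℕ.+ suc n C suc j       ≡⟨ cong (λ c → c ℕ.+ c) (nCk+nC[k+1]≡[n+1]C[k+1] n j) ⟨
  (n C j ℕ.+ n C suc j) ℕ.+ (n C j ℕ.+ n C suc j) ∎
  where
  open ≡-Reasoning
  n = 2 ℕ.* j
  1+n≡j+[1+j] : suc n ≡ j ℕ.+ suc j
  1+n≡j+[1+j] = trans (cong (λ t → suc (j ℕ.+ t)) (ℕP.+-identityʳ j)) (sym (ℕP.+-suc j j))
  symmetric : suc n C j ≡ suc n C suc j
  symmetric = trans (nCk≡nC[n∸k] (ℕP.≤-trans (ℕP.m≤m+n j (j ℕ.+ 0)) (ℕP.n≤1+n n)))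
                    (cong (suc n C_) (trans (cong (_∸ j) 1+n≡j+[1+j]) (ℕP.m+n∸m≡n j (suc j))))

module _ (ε : ℤ) (ε²≡1 : ε * ε ≡ 1ℤ) where

  β : ℕ → ℕ → ℤ
  β j r = (- ε) ^ r * + (2 ℕ.* j C r)

  β-step : ∀ j r → β j (suc (suc r)) + β j r - (+ 2 * ε) * β j (suc r) ≡ β (suc j) (suc (suc r))
  β-step j r = begin
    s * (s * t) * + c + t * + a - (+ 2 * ε) * (s * t * + b)
      ≡⟨ cong (λ u → s * (s * t) * + c + u - (+ 2 * ε) * (s * t * + b)) t*a≡ε²*t*a ⟩
    s * (s * t) * + c + ε * ε * (t * + a) - (+ 2 * ε) * (s * t * + b)
      ≡⟨ collect ε t (+ a) (+ b) (+ c) ⟩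
    s * (s * t) * + ((a ℕ.+ b) ℕ.+ (b ℕ.+ c))
      ≡⟨ cong (λ u → s * (s * t) * + u) (trans (cong (_C suc (suc r)) (ℕP.*-suc 2 j)) (double-pascal n r)) ⟨
    β (suc j) (suc (suc r)) ∎
    where
    open ≡-Reasoning
    s = - ε
    t = s ^ r
    n = 2 ℕ.* j
    a = n C r
    b = n C suc r
    c = n C suc (suc r)
    t*a≡ε²*t*a : t * + a ≡ ε * ε * (t * + a)
    t*a≡ε²*t*a = sym (trans (cong (_* (t * + a)) ε²≡1) (ℤP.*-identityˡ (t * + a)))
    collect : ∀ e t a b c → (- e) * ((- e) * t) * c + e * e * (t * a) - (+ 2 * e) * ((- e) * t * b)
                          ≡ (- e) * ((- e) * t) * ((a + b) + (b + c))
    collect = ℤ-Solver.solve-∀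

  β-central : ∀ j → β j (suc j) + β j (suc j) - (+ 2 * ε) * β j j ≡ β (suc j) (suc j)
  β-central j = begin
    s * t * + c + s * t * + c - (+ 2 * ε) * (t * + b)
      ≡⟨ collect ε t (+ b) (+ c) ⟩
    s * t * + ((b ℕ.+ c) ℕ.+ (b ℕ.+ c))
      ≡⟨ cong (λ u → s * t * + u) (trans (cong (_C suc j) (ℕP.*-suc 2 j)) (central-pascal j)) ⟨
    β (suc j) (suc j) ∎
    where
    open ≡-Reasoning
    s = - ε
    t = s ^ j
    b = 2 ℕ.* j C j
    c = 2 ℕ.* j C suc j
    collect : ∀ e t b c → (- e) * t * c + (- e) * t * c - (+ 2 * e) * (t * b) ≡ (- e) * t * ((b + c) + (b + c))
    collect = ℤ-Solver.solve-∀

  α≡β : ∀ j k → α ε j k ≡ β j (j ℕ.+ k)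
  α≡β′ : ∀ j k {r} → j ℕ.+ k ≡ r → α ε j k ≡ β j r

  α≡β zero    zero    = refl
  α≡β zero    (suc k) = sym (ℤP.*-zeroʳ ((- ε) ^ suc k))
  α≡β (suc j) zero    = begin
    α ε j 1 + α ε j 1 - (+ 2 * ε) * α ε j 0
      ≡⟨ cong₂ (λ u v → u + u - (+ 2 * ε) * v) (α≡β′ j 1 (ℕP.+-comm j 1)) (α≡β′ j 0 (ℕP.+-identityʳ j)) ⟩
    β j (suc j) + β j (suc j) - (+ 2 * ε) * β j j
      ≡⟨ β-central j ⟩
    β (suc j) (suc j)
      ≡⟨ cong (β (suc j)) (ℕP.+-identityʳ (suc j)) ⟨
    β (suc j) (suc j ℕ.+ 0) ∎
    where open ≡-Reasoning
  α≡β (suc j) (suc k) = begin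
    α ε j (suc (suc k)) + α ε j k - (+ 2 * ε) * α ε j (suc k)
      ≡⟨ cong₂ (λ u v → u + α ε j k - (+ 2 * ε) * v)
               (α≡β′ j (suc (suc k)) (trans (ℕP.+-suc j (suc k)) (cong suc (ℕP.+-suc j k))))
               (α≡β′ j (suc k) (ℕP.+-suc j k)) ⟩
    β j (suc (suc r)) + α ε j k - (+ 2 * ε) * β j (suc r)
      ≡⟨ cong (λ u → β j (suc (suc r)) + u - (+ 2 * ε) * β j (suc r)) (α≡β j k) ⟩
    β j (suc (suc r)) + β j r - (+ 2 * ε) * β j (suc r)
      ≡⟨ β-step j r ⟩
    β (suc j) (suc (suc r))
      ≡⟨ cong (β (suc j)) (cong suc (ℕP.+-suc j k)) ⟨
    β (suc j) (suc j ℕ.+ suc k) ∎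
    where
    open ≡-Reasoning
    r = j ℕ.+ k

  α≡β′ j k j+k≡r = trans (α≡β j k) (cong (β j) j+k≡r)

  even-power : ∀ k → (- ε) ^ (2 ℕ.* k) ≡ 1ℤ
  even-power k = begin
    (- ε) ^ (2 ℕ.* k)   ≡⟨ ℤP.^-*-assoc (- ε) 2 k ⟨
    ((- ε) ^ 2) ^ k     ≡⟨ cong (_^ k) (trans (square ε) ε²≡1) ⟩
    1ℤ ^ k              ≡⟨ ℤP.^-zeroˡ k ⟩
    1ℤ                  ∎
    where
    open ≡-Reasoning
    square : ∀ e → (- e) * ((- e) * 1ℤ) ≡ e * e
    square = ℤ-Solver.solve-∀

  α-diagonal : ∀ k i → α ε (k ℕ.+ i) k ≡ (- ε) ^ i * + (2 ℕ.* (k ℕ.+ i) C i)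
  α-diagonal k i = begin
    α ε (k ℕ.+ i) k                          ≡⟨ α≡β′ (k ℕ.+ i) k (index k i) ⟩
    (- ε) ^ (i ℕ.+ 2 ℕ.* k) * + (n C (i ℕ.+ 2 ℕ.* k))  ≡⟨ cong₂ (λ u v → u * + v) sign binomial ⟩
    (- ε) ^ i * + (n C i)                    ∎
    where
    open ≡-Reasoning
    n = 2 ℕ.* (k ℕ.+ i)
    index : ∀ k i → (k ℕ.+ i) ℕ.+ k ≡ i ℕ.+ 2 ℕ.* k
    index = ℕ-Solver.solve-∀
    n-split : ∀ k i → 2 ℕ.* (k ℕ.+ i) ≡ (i ℕ.+ 2 ℕ.* k) ℕ.+ i
    n-split = ℕ-Solver.solve-∀
    sign : (- ε) ^ (i ℕ.+ 2 ℕ.* k) ≡ (- ε) ^ i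
    sign = trans (ℤP.^-distribˡ-+-* (- ε) i (2 ℕ.* k))
                 (trans (cong ((- ε) ^ i *_) (even-power k)) (ℤP.*-identityʳ _))
    binomial : n C (i ℕ.+ 2 ℕ.* k) ≡ n C i
    binomial = trans (nCk≡nC[n∸k] (subst (i ℕ.+ 2 ℕ.* k ≤_) (sym (n-split k i)) (ℕP.m≤m+n _ i)))
                     (cong (n C_) (trans (cong (_∸ (i ℕ.+ 2 ℕ.* k)) (n-split k i)) (ℕP.m+n∸m≡n (i ℕ.+ 2 ℕ.* k) i)))

  α-vanish : ∀ {j k} → j < k → α ε j k ≡ 0ℤ
  α-vanish {j} {k} j<k = begin
    α ε j k                                   ≡⟨ α≡β j k ⟩
    (- ε) ^ (j ℕ.+ k) * + (2 ℕ.* j C (j ℕ.+ k)) ≡⟨ cong (λ c → (- ε) ^ (j ℕ.+ k) * + c) (k>n⇒nCk≡0 2j<j+k) ⟩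
    (- ε) ^ (j ℕ.+ k) * 0ℤ                    ≡⟨ ℤP.*-zeroʳ ((- ε) ^ (j ℕ.+ k)) ⟩
    0ℤ                                        ∎
    where
    open ≡-Reasoning
    2j<j+k : 2 ℕ.* j < j ℕ.+ k
    2j<j+k = subst (ℕ._< j ℕ.+ k) (cong (j ℕ.+_) (sym (ℕP.+-identityʳ j))) (ℕP.+-monoʳ-< j j<k)

-- Gaussian polynomials

module Gaussian (d′ : ℕ) where

  d : ℕ
  d = suc d′

  qfac : ℕ → Series
  qfac i = poch 1ℤ d d i

  qfac⊛inv : ∀ i → qfac i ⊛ inv (qfac i) ≈ one
  qfac⊛inv i = ⊛-inverseʳ (qfac i) (ΠS<-constant-term i (λ r → one ⊖ mono (d ℕ.+ d ℕ.* r) 1ℤ)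
    λ r → cong (λ c → 1ℤ - c) (mono-≢ (d ℕ.+ d ℕ.* r) 1ℤ {0} λ ()))

  inv-qfac-suc : ∀ i → inv (qfac i) ≈ (one ⊖ X^ (d ℕ.+ d ℕ.* i)) ⊛ inv (qfac (suc i))
  inv-qfac-suc i = inverse-peel (qfac i) (one ⊖ X^ (d ℕ.+ d ℕ.* i)) (inv (qfac i)) (inv (qfac (suc i)))
                                (qfac⊛inv i) (qfac⊛inv (suc i))

  inv-qfac-idx : ∀ {a b} → a ≡ b → inv (qfac a) ≈ inv (qfac b)
  inv-qfac-idx refl = ≈-refl

  gauss-idx : ∀ {m m′} k → m ≡ m′ → gauss d m k ≈ gauss d m′ k
  gauss-idx k refl = ≈-refl

  gauss-qfac : ∀ m a → gauss d (m ℕ.+ a) a ≈ qfac (m ℕ.+ a) ⊛ inv (qfac a) ⊛ inv (qfac m)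
  gauss-qfac m a with a ℕ.≤? m ℕ.+ a
  ... | yes _   = ⊛-congˡ (qfac (m ℕ.+ a) ⊛ inv (qfac a)) (inv-qfac-idx (ℕP.m+n∸n≡m m a))
  ... | no a≰m+a = ⊥-elim (a≰m+a (ℕP.m≤n+m a m))

  inv-qfac-0 : inv (qfac 0) ≈ one
  inv-qfac-0 = ≈-trans (≈-sym (⊛-identityˡ (inv one))) (qfac⊛inv 0)

  gauss-zero : ∀ n → gauss d n 0 ≈ one
  gauss-zero n with 0 ℕ.≤? n
  ... | yes _  = ≈-trans (⊛-congʳ (inv (qfac n)) (≈-trans (⊛-congˡ (qfac n) inv-qfac-0) (⊛-identityʳ (qfac n))))
                         (qfac⊛inv n)
  ... | no 0≰n = ⊥-elim (0≰n z≤n)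

  gauss-diag : ∀ a → gauss d a a ≈ one
  gauss-diag a = ≈-trans (gauss-qfac 0 a) (≈-trans (⊛-congˡ (qfac a ⊛ inv (qfac a)) inv-qfac-0)
                                          (≈-trans (⊛-identityʳ _) (qfac⊛inv a)))

  -- from 1 - u v = (1 - v) + v (1 - u) with u = p^{a+1}, v = p^{m+1}
  q-pascal : ∀ m a → gauss d (suc m ℕ.+ suc a) (suc a) ≈
                     gauss d (m ℕ.+ suc a) (suc a) ⊕ X^ (d ℕ.* suc m) ⊛ gauss d (suc m ℕ.+ a) a
  q-pascal m a = begin
    gauss d (suc m ℕ.+ suc a) (suc a)
      ≈⟨ gauss-qfac (suc m) (suc a) ⟩
    F ⊛ (one ⊖ X^ (d ℕ.+ d ℕ.* (m ℕ.+ suc a))) ⊛ Iₐ₊ ⊛ Iₘ₊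
      ≈⟨ ⊛-congʳ Iₘ₊ (⊛-congʳ Iₐ₊ (⊛-congˡ F (⊕-congˡ one (neg-cong
           (≈-trans (X^-idx (exponent d m a)) (≈-sym (X^-+ (d ℕ.+ d ℕ.* a) (d ℕ.+ d ℕ.* m)))))))) ⟩
    F ⊛ (one ⊖ u ⊛ v) ⊛ Iₐ₊ ⊛ Iₘ₊
      ≈⟨ solve 5 (λ F u v Iₐ₊ Iₘ₊ → F :* (con 1ℤ :- u :* v) :* Iₐ₊ :* Iₘ₊
                                  := F :* Iₐ₊ :* ((con 1ℤ :- v) :* Iₘ₊) :+ v :* (F :* ((con 1ℤ :- u) :* Iₐ₊) :* Iₘ₊))
           ≈-refl F u v Iₐ₊ Iₘ₊ ⟩
    F ⊛ Iₐ₊ ⊛ ((one ⊖ v) ⊛ Iₘ₊) ⊕ v ⊛ (F ⊛ ((one ⊖ u) ⊛ Iₐ₊) ⊛ Iₘ₊)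
      ≈⟨ ⊕-cong (⊛-congˡ (F ⊛ Iₐ₊) (inv-qfac-suc m))
                (⊛-congˡ v (⊛-congʳ Iₘ₊ (⊛-congˡ F (inv-qfac-suc a)))) ⟨
    F ⊛ Iₐ₊ ⊛ inv (qfac m) ⊕ v ⊛ (F ⊛ inv (qfac a) ⊛ Iₘ₊)
      ≈⟨ ⊕-cong (gauss-qfac m (suc a))
                (⊛-cong (X^-idx (ℕP.*-suc d m))
                        (≈-trans (gauss-qfac (suc m) a)
                                 (⊛-congʳ Iₘ₊ (⊛-congʳ (inv (qfac a)) (qfac-idx (sym (ℕP.+-suc m a))))))) ⟨
    gauss d (m ℕ.+ suc a) (suc a) ⊕ X^ (d ℕ.* suc m) ⊛ gauss d (suc m ℕ.+ a) a ∎
    where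
    open ≈-Reasoning
    F = qfac (m ℕ.+ suc a)
    Iₐ₊ = inv (qfac (suc a))
    Iₘ₊ = inv (qfac (suc m))
    u = X^ (d ℕ.+ d ℕ.* a)
    v = X^ (d ℕ.+ d ℕ.* m)
    qfac-idx : ∀ {i j} → i ≡ j → qfac i ≈ qfac j
    qfac-idx refl = ≈-refl
    exponent : ∀ d m a → d ℕ.+ d ℕ.* (m ℕ.+ suc a) ≡ (d ℕ.+ d ℕ.* a) ℕ.+ (d ℕ.+ d ℕ.* m)
    exponent = ℕ-Solver.solve-∀

  module _ {z : ℕ → Series} (z≈X^ : ∀ r → z r ≈ X^ (suc (d ℕ.* r))) where

    complete-one-variable : ∀ a → complete z a 1 ≈ X^ a
    complete-one-variable zero    = ≈-sym X^0
    complete-one-variable (suc a) = begin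
      zeroS ⊕ z 0 ⊛ complete z a 1   ≈⟨ mk≈ (λ n → ℤP.+-identityˡ _) ⟩
      z 0 ⊛ complete z a 1
        ≈⟨ ⊛-cong (≈-trans (z≈X^ 0) (X^-idx (cong suc (ℕP.*-zeroʳ d)))) (complete-one-variable a) ⟩
      X^ 1 ⊛ X^ a                    ≈⟨ X^-+ 1 a ⟩
      X^ (suc a)                     ∎
      where open ≈-Reasoning

    complete≈X^⊛gauss : ∀ m a → complete z a (suc m) ≈ X^ a ⊛ gauss d (m ℕ.+ a) a
    complete≈X^⊛gauss zero    a = begin
      complete z a 1        ≈⟨ complete-one-variable a ⟩
      X^ a                  ≈⟨ ⊛-identityʳ (X^ a) ⟨
      X^ a ⊛ one            ≈⟨ ⊛-congˡ (X^ a) (gauss-diag a) ⟨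
      X^ a ⊛ gauss d a a    ∎
      where open ≈-Reasoning
    complete≈X^⊛gauss (suc m) zero = ≈-sym (≈-trans (⊛-cong X^0 (gauss-zero (suc m ℕ.+ 0))) (⊛-identityˡ one))
    complete≈X^⊛gauss (suc m) (suc a) = begin
      complete z (suc a) (suc m) ⊕ z (suc m) ⊛ complete z a (suc (suc m))
        ≈⟨ ⊕-cong (complete≈X^⊛gauss m (suc a)) (⊛-cong (z≈X^ (suc m)) (complete≈X^⊛gauss (suc m) a)) ⟩
      X^ (suc a) ⊛ G₁ ⊕ X^ (suc (d ℕ.* suc m)) ⊛ (X^ a ⊛ G₂)
        ≈⟨ ⊕-congˡ (X^ (suc a) ⊛ G₁) (≈-trans (≈-sym (⊛-assoc (X^ (suc (d ℕ.* suc m))) (X^ a) G₂))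
                                               (⊛-congʳ G₂ exponents)) ⟩
      X^ (suc a) ⊛ G₁ ⊕ (X^ (suc a) ⊛ X^ (d ℕ.* suc m)) ⊛ G₂
        ≈⟨ solve 4 (λ x G₁ y G₂ → x :* G₁ :+ (x :* y) :* G₂ := x :* (G₁ :+ y :* G₂))
             ≈-refl (X^ (suc a)) G₁ (X^ (d ℕ.* suc m)) G₂ ⟩
      X^ (suc a) ⊛ (G₁ ⊕ X^ (d ℕ.* suc m) ⊛ G₂)
        ≈⟨ ⊛-congˡ (X^ (suc a)) (q-pascal m a) ⟨
      X^ (suc a) ⊛ gauss d (suc m ℕ.+ suc a) (suc a) ∎
      where
      open ≈-Reasoning
      G₁ = gauss d (m ℕ.+ suc a) (suc a)
      G₂ = gauss d (suc m ℕ.+ a) a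
      exponents : X^ (suc (d ℕ.* suc m)) ⊛ X^ a ≈ X^ (suc a) ⊛ X^ (d ℕ.* suc m)
      exponents = begin
        X^ (suc (d ℕ.* suc m)) ⊛ X^ a   ≈⟨ X^-+ (suc (d ℕ.* suc m)) a ⟩
        X^ (suc (d ℕ.* suc m) ℕ.+ a)    ≈⟨ X^-idx (cong suc (ℕP.+-comm (d ℕ.* suc m) a)) ⟩
        X^ (suc a ℕ.+ d ℕ.* suc m)      ≈⟨ X^-+ (suc a) (d ℕ.* suc m) ⟨
        X^ (suc a) ⊛ X^ (d ℕ.* suc m)   ∎

-- Specialisation to z_n = q^{1 + d (n - 1)}

Vgen≈complete : ∀ e ε j m → Vgen e ε j m ≈ complete (λ n → frac ε (e (suc n))) j m
Vgen≈complete e ε zero    m = ≈-refl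
Vgen≈complete e ε (suc j) m = ΣS<-cong m (λ n → ⊛-congˡ (frac ε (e (suc n))) (Vgen≈complete e ε j (suc n)))

module _ (ε : ℤ) {e : ℕ} (1≤e : 1 ≤ e) where

  Ord≥-frac : Ord≥ 1 (frac ε e)
  Ord≥-frac = Ord≥-weaken (ℕP.≤-trans 1≤e (ℕP.m≤m+n e 0))
    (Ord≥-⊛ (Ord≥-mono e 1ℤ) (Ord≥-0 (inv ((one ⊖ mono e ε) ⊛ (one ⊖ mono e ε)))))

  frac⊛[1-εq^e]²≈q^e : frac ε e ⊛ ((one ⊕ neg (const ε ⊛ X^ e)) ⊛ (one ⊕ neg (const ε ⊛ X^ e))) ≈ X^ e
  frac⊛[1-εq^e]²≈q^e = begin
    (X^ e ⊛ inv U) ⊛ (L ⊛ L)   ≈⟨ ⊛-congˡ (X^ e ⊛ inv U) (⊛-cong L≈ L≈) ⟨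
    (X^ e ⊛ inv U) ⊛ U         ≈⟨ solve 3 (λ X I U → (X :* I) :* U := X :* (U :* I)) ≈-refl (X^ e) (inv U) U ⟩
    X^ e ⊛ (U ⊛ inv U)         ≈⟨ ⊛-congˡ (X^ e) (⊛-inverseʳ U U0≡1) ⟩
    X^ e ⊛ one                 ≈⟨ ⊛-identityʳ (X^ e) ⟩
    X^ e                       ∎
    where
    open ≈-Reasoning
    L = one ⊕ neg (const ε ⊛ X^ e)
    U = (one ⊖ mono e ε) ⊛ (one ⊖ mono e ε)
    L≈ : one ⊖ mono e ε ≈ L
    L≈ = ⊕-congˡ one (neg-cong (mono≈const⊛X^ e ε))
    U0≡1 : U 0 ≡ 1ℤ
    U0≡1 = trans (ℤP.+-identityˡ _)
                 (cong (λ c → (1ℤ - c) * (1ℤ - c)) (mono-≢ e ε {0} (λ 0≡e → ℕP.<⇒≢ 1≤e 0≡e)))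

module Specialisation (e : ℕ → ℕ) (d′ : ℕ) (e-arith : ∀ r → e (suc r) ≡ suc (suc d′ ℕ.* r))
                (ε : ℤ) (ε²≡1 : ε * ε ≡ 1ℤ) where

  x z : ℕ → Series
  x n = frac ε (e (suc n))
  z n = X^ (e (suc n))

  1≤e : ∀ n → 1 ≤ e (suc n)
  1≤e n = subst (1 ≤_) (sym (e-arith n)) (s≤s z≤n)

  ord-x : ∀ n → Ord≥ 1 (x n)
  ord-x n = Ord≥-frac ε (1≤e n)

  ord-z : ∀ n → Ord≥ 1 (z n)
  ord-z n = Ord≥-weaken (1≤e n) (Ord≥-mono (e (suc n)) 1ℤ)

  open ProductFormula ε ε²≡1 x z ord-x ord-z (λ n → frac⊛[1-εq^e]²≈q^e ε (1≤e n))
  open CompleteSums x ord-x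
  open CompletePairs z ord-z
  open Gaussian d′

  lhs≡A : ∀ k m J N → N < suc J → LHSpart (λ j → Vgen e ε j m) ε k J N ≡ A k m N
  lhs≡A k m J N N≤J = begin
    LHSpart (λ j → Vgen e ε j m) ε k J N  ≡⟨ coeff (ΣS<-cong (suc J) term≈) N ⟩
    ΣS< (suc J) (λ i → u (k ℕ.+ i)) N     ≡⟨ ΣS<≡Σ∞ (Summable-drop k (Σcomplete-summable αₖ m)) N≤J ⟩
    Σ∞ (λ i → u (k ℕ.+ i)) N              ≡⟨ coeff (Σ∞-drop k (Σcomplete-summable αₖ m) u≈0) N ⟨
    A k m N                               ∎
    where
    open ≡-Reasoning
    αₖ = λ j → α ε j k
    u = weightedTerm αₖ m
    term≈ : ∀ i → ((- ε) ^ i * + (2 ℕ.* (k ℕ.+ i) C i)) · Vgen e ε (k ℕ.+ i) m ≈ u (k ℕ.+ i)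
    term≈ i = mk≈ λ n → cong₂ _*_ (sym (α-diagonal ε ε²≡1 k i)) (coeff (Vgen≈complete e ε (k ℕ.+ i) m) n)
    u≈0 : ∀ j → j < k → u j ≈ zeroS
    u≈0 j j<k = mk≈ λ n → cong (_* complete x j m n) (α-vanish ε ε²≡1 j<k)

  poch≈P : ∀ m → poch ε 1 d m ≈ P m
  poch≈P m = ΠS<-cong m λ r → ⊕-congˡ one (neg-cong
    (≈-trans (mono≈const⊛X^ (suc (d ℕ.* r)) ε) (⊛-congˡ (const ε) (X^-idx (sym (e-arith r))))))

  z≈X^ : ∀ r → z r ≈ X^ (suc (d ℕ.* r))
  z≈X^ r = X^-idx (e-arith r)

  X^k⊛H-term≈pairTerm : ∀ k m′ j →
    X^ k ⊛ (gauss d (m′ ℕ.+ j) j ⊛ gauss d (m′ ℕ.+ k ℕ.+ j) (k ℕ.+ j) ⊛ X^ (2 ℕ.* j)) ≈ pairTerm k (suc m′) j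
  X^k⊛H-term≈pairTerm k m′ j = begin
    X^ k ⊛ (G ⊛ Gₖ ⊛ X^ (2 ℕ.* j))
      ≈⟨ solve 4 (λ a G Gₖ b → a :* (G :* Gₖ :* b) := (a :* b) :* (Gₖ :* G)) ≈-refl (X^ k) G Gₖ (X^ (2 ℕ.* j)) ⟩
    (X^ k ⊛ X^ (2 ℕ.* j)) ⊛ (Gₖ ⊛ G)
      ≈⟨ ⊛-congʳ (Gₖ ⊛ G) (≈-trans (X^-+ k (2 ℕ.* j))
           (≈-trans (X^-idx (exponent k j)) (≈-sym (X^-+ (k ℕ.+ j) j)))) ⟩
    (X^ (k ℕ.+ j) ⊛ X^ j) ⊛ (Gₖ ⊛ G)
      ≈⟨ solve 4 (λ a b Gₖ G → (a :* b) :* (Gₖ :* G) := (a :* Gₖ) :* (b :* G)) ≈-refl (X^ (k ℕ.+ j)) (X^ j) Gₖ G ⟩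
    (X^ (k ℕ.+ j) ⊛ Gₖ) ⊛ (X^ j ⊛ G)
      ≈⟨ ⊛-cong (≈-trans (⊛-congˡ (X^ (k ℕ.+ j)) (gauss-idx (k ℕ.+ j) (ℕP.+-assoc m′ k j)))
                         (≈-sym (complete≈X^⊛gauss z≈X^ m′ (k ℕ.+ j))))
                (≈-sym (complete≈X^⊛gauss z≈X^ m′ j)) ⟩
    pairTerm k (suc m′) j ∎
    where
    open ≈-Reasoning
    G = gauss d (m′ ℕ.+ j) j
    Gₖ = gauss d (m′ ℕ.+ k ℕ.+ j) (k ℕ.+ j)
    exponent : ∀ k j → k ℕ.+ 2 ℕ.* j ≡ (k ℕ.+ j) ℕ.+ j
    exponent = ℕ-Solver.solve-∀

  rhs≡P²B : ∀ k m′ J N → N < suc J →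
    (poch ε 1 d (suc m′) ⊛ poch ε 1 d (suc m′) ⊛ X^ k ⊛ Hpart d k (suc m′) J) N
    ≡ ((P (suc m′) ⊛ P (suc m′)) ⊛ B k (suc m′)) N
  rhs≡P²B k m′ J N N≤J = trans (coeff factor N) (⊛-ΣS<≡⊛-Σ∞ Q (pairTerm-summable k m) N≤J)
    where
    open ≈-Reasoning
    m = suc m′
    Q = P m ⊛ P m
    H = Hpart d k m J
    factor : poch ε 1 d m ⊛ poch ε 1 d m ⊛ X^ k ⊛ H ≈ Q ⊛ ΣS< (suc J) (pairTerm k m)
    factor = begin
      poch ε 1 d m ⊛ poch ε 1 d m ⊛ X^ k ⊛ H  ≈⟨ ⊛-congʳ H (⊛-congʳ (X^ k) (⊛-cong (poch≈P m) (poch≈P m))) ⟩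
      Q ⊛ X^ k ⊛ H                            ≈⟨ ⊛-assoc Q (X^ k) H ⟩
      Q ⊛ (X^ k ⊛ H)
        ≈⟨ ⊛-congˡ Q (≈-trans (⊛-distribˡ-ΣS< (suc J) (X^ k) _) (ΣS<-cong (suc J) (X^k⊛H-term≈pairTerm k m′))) ⟩
      Q ⊛ ΣS< (suc J) (pairTerm k m)          ∎

  partial-sums-agree : ∀ k m′ N → ∃[ B ] ∃[ c ] ((J : ℕ) → B ≤ J →
               (LHSpart (λ j → Vgen e ε j (suc m′)) ε k J N ≡ c)
               × ((poch ε 1 d (suc m′) ⊛ poch ε 1 d (suc m′) ⊛ X^ k ⊛ Hpart d k (suc m′) J) N ≡ c))
  partial-sums-agree k m′ N = N , A k (suc m′) N , λ J N≤J →
    lhs≡A k (suc m′) J N (s≤s N≤J) ,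
    trans (rhs≡P²B k m′ J N (s≤s N≤J)) (sym (coeff (A≈P²B (suc m′) k) N))

theorem1 : (k m : ℕ) → 1 ≤ m → (ε : ℤ) → (ε ≡ 1ℤ ⊎ ε ≡ -1ℤ) →
    ((N : ℕ) → ∃[ B ] ∃[ c ] ((J : ℕ) → B ≤ J →
        (LHSpart (λ j → V ε j m) ε k J N ≡ c)
        × ((poch ε 1 1 m ⊛ poch ε 1 1 m ⊛ X^ k ⊛ Hpart 1 k m J) N ≡ c)))
    × ((N : ℕ) → ∃[ B ] ∃[ c ] ((J : ℕ) → B ≤ J →
        (LHSpart (λ j → W ε j m) ε k J N ≡ c)
        × ((poch ε 1 2 m ⊛ poch ε 1 2 m ⊛ X^ k ⊛ Hpart 2 k m J) N ≡ c)))
theorem1 k (suc m′) (s≤s z≤n) ε ε≡±1 =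
  Specialisation.partial-sums-agree (λ n → n) 0 e-V ε (square≡1 ε≡±1) k m′ ,
  Specialisation.partial-sums-agree (λ n → 2 ℕ.* n ∸ 1) 1 e-W ε (square≡1 ε≡±1) k m′
  where
  e-V : ∀ r → suc r ≡ suc (1 ℕ.* r)
  e-V r = cong suc (sym (ℕP.*-identityˡ r))
  e-W : ∀ r → 2 ℕ.* suc r ∸ 1 ≡ suc (2 ℕ.* r)
  e-W r = cong (_∸ 1) (ℕP.*-suc 2 r)
  square≡1 : ∀ {ε} → ε ≡ 1ℤ ⊎ ε ≡ -1ℤ → ε * ε ≡ 1ℤ
  square≡1 (inj₁ refl) = refl
  square≡1 (inj₂ refl) = refl
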